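{- Let $K$ be a positive integer and $\ell$ an integer with $0\le\ell\le 2K$ and $K\equiv \ell\pmod 2$. Then \[ C_{K,\ell}^{2K}(q)=\frac{q^{s(K,\ell,2K)}}{J_{1}^3}\,f_{K+1,K+1,1}\big(q^{1+\frac{1}{2}(K+\ell)},q^{1-\frac{1}{2}(K-\ell)},q\big). \]
   Context: Let $q=e^{2\pi i\tau}$ with $\operatorname{Im}\tau>0$, and for real $\alpha$ write $q^{\alpha}:=e^{2\pi i \tau\alpha}$. Let $(x;q)_\infty=\prod_{i\ge0}(1-q^ix)$, $J_1=(q;q)_\infty$. For $x,y\in\mathbb{C}^*$ and positive integers $a,b,c$ define \[ f_{a,b,c}(x,y,q):=\Big(\sum_{r,s\ge0}-\sum_{r,s<0}\Big)(-1)^{r+s}x^ry^sq^{a\binom{r}{2}+brs+c\binom{s}{2}}. \] For a positive integer $N$, an integer $\ell\in\{0,\dots,N\}$ and an integer $m\equiv\ell\pmod 2$, put $s(m,\ell,N):=-\tfrac18+\tfrac{(\ell+1)^2}{4(N+2)}-\tfrac{m^2}{4N}$, and let $C_{m,\ell}^N(q)$ be the level-$N$ string function of $A_1^{(1)}$ for highest weight $(N-\ell)\Lambda_0+\ell\Lambda_1$ and maximal weight $(N-m)\Lambda_0+m\Lambda_1$; concretely, \[ C_{m,\ell}^N(q)=\frac{q^{s(m,\ell,N)}}{(q;q)_\infty^3}\Big(\sum_{\substack{j\ge1\\k\le0}}-\sum_{\substack{j\le0\\k\ge1}}\Big)(-1)^{k-j}q^{\binom{k-j}{2}-Njk+\frac12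 k(m-\ell)+\frac12 j(m+\ell)}. \] -}

module Defs where

-- Every series in the statement is a double sum
-- Σ_{(r,s)} ε(r,s) q^{E(r,s)} with integer exponents E, and for each n only
-- finitely many (r,s) contribute to q^n.  We represent the coefficient of q^n
-- via truncation to the box |r|,|s| ≤ B; the true coefficient is the eventual
-- (stable) value as B → ∞.

open import Data.Nat as ℕ using (ℕ; zero; suc)
import Data.Nat.DivMod as ℕD
open import Data.Integer as ℤ using (ℤ; +_; -[1+_]; _+_; _*_; _-_; -_; ∣_∣; 0ℤ; 1ℤ; -1ℤ; _≤_; _<_; _≤?_; _≟_)
import Data.Integer.DivMod as ℤD
open import Data.List using (List; map; upTo; foldr; concatMap)
open import Data.Bool using (Bool; true; false; _∧_; if_then_else_)
open import Relation.Nullary.Decidable using (does)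

-- binomial coefficient (r choose 2) = r(r-1)/2 for an integer r (always ≥ 0)
binom2 : ℤ → ℤ
binom2 r = + (ℕD._/_ ∣ r * (r - 1ℤ) ∣ 2)

half : ℤ → ℤ
half t = ℤD._/_ t (+ 2)

neg1pow : ℤ → ℤ
neg1pow t with ℕD._%_ ∣ t ∣ 2
... | zero  = 1ℤ
... | suc _ = -1ℤ

box : ℕ → List ℤ
box B = map (λ i → + i - + B) (upTo (suc (B ℕ.+ B)))

sumℤ : List ℤ → ℤ
sumℤ = foldr _+_ 0ℤ

boxSum : ℕ → (ℤ → ℤ → ℤ) → ℤ
boxSum B g = sumℤ (concatMap (λ r → map (λ s → g r s) (box B)) (box B))

onExp : ℤ → ℤ → ℤ → ℤ
onExp n e w = if does (e ≟ n) then w else 0ℤ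

nonneg : ℤ → Bool
nonneg r = does (0ℤ ≤? r)

neg : ℤ → Bool
neg r = does (r ≤? -1ℤ)

-- Coefficient of q^n (truncated to |r|,|s| ≤ B) in
--   f_{a,b,c}(q^α, q^β, q)
--   = (Σ_{r,s≥0} - Σ_{r,s<0}) (-1)^{r+s} q^{α r + β s + a C(r,2) + b r s + c C(s,2)}.
fExp : ℤ → ℤ → ℤ → ℤ → ℤ → ℤ → ℤ → ℤ
fExp a b c α β r s = α * r + β * s + a * binom2 r + b * r * s + c * binom2 s

fCoeff : ℤ → ℤ → ℤ → ℤ → ℤ → ℕ → ℤ → ℤ
fCoeff a b c α β B n = boxSum B λ r s →
  onExp n (fExp a b c α β r s)
    (if nonneg r ∧ nonneg s then neg1pow (r + s)
     else if neg r ∧ neg s then - neg1pow (r + s)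
     else 0ℤ)

-- Coefficient of q^n (truncated to |j|,|k| ≤ B) in the double sum part of the
-- string function:
--   C^N_{m,ℓ}(q) = q^{s(m,ℓ,N)} / (q;q)_∞^3 · S^N_{m,ℓ}(q),
--   S^N_{m,ℓ}(q) = (Σ_{j≥1,k≤0} - Σ_{j≤0,k≥1}) (-1)^{k-j}
--                    q^{C(k-j,2) - N j k + ½ k(m-ℓ) + ½ j(m+ℓ)}.
-- (half is exact since m ≡ ℓ mod 2.)
stringExp : ℤ → ℤ → ℤ → ℤ → ℤ → ℤ
stringExp N m ℓ j k =
  binom2 (k - j) - N * j * k + half (k * (m - ℓ)) + half (j * (m + ℓ))

stringCoeff : ℤ → ℤ → ℤ → ℕ → ℤ → ℤ
stringCoeff N m ℓ B n = boxSum B λ j k →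
  onExp n (stringExp N m ℓ j k)
    (if does (1ℤ ≤? j) ∧ does (k ≤? 0ℤ) then neg1pow (k - j)
     else if does (j ≤? 0ℤ) ∧ does (1ℤ ≤? k) then - neg1pow (k - j)
     else 0ℤ)

-- Write P = (K + ℓ)/2 and Q = (K − ℓ)/2, so that K = P + Q. The substitutions
-- (j, k) ↦ (2j, −j−k) and (j, k) ↦ (1−2k, j+k−1) both carry the exponent of the string-function
-- double sum to the exponent of f_{K+1,K+1,1}(q^{1+P}, q^{1−Q}, q), and at every (j, k) the sign
-- of the string sum is the sum of the quadrant signs of f at the two images, minus a correction
-- living on the line j = 0. The first image runs over the even values of r and the second over the
-- odd ones, so together they produce every term of f exactly once; the correction cancels under the
-- involution k ↦ 1 − 2Q − k, which preserves its exponent and reverses the sign (−1)^k.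
-- Coefficients are taken in boxes |r|, |s| ≤ B: on the quadrants where f has nonzero terms its
-- exponent grows quadratically, so the terms contributing to a fixed q^n lie in a fixed box, and
-- once B is large enough every reindexing above is exact.

module Submission where

open import Defs
open import Data.Nat using (ℕ)

module Arithmetic where

  open import Data.Nat as ℕ using (ℕ; zero; suc)
  import Data.Nat.Properties as ℕP
  import Data.Nat.DivMod as ℕD
  import Data.Nat.Tactic.RingSolver as ℕRing
  open import Data.Integer as ℤ using (ℤ; +_; -[1+_]; _+_; _*_; _-_; -_; ∣_∣; 0ℤ; 1ℤ; -1ℤ)
  import Data.Integer.Properties as ℤP
  import Data.Integer.DivMod as ℤD
  open import Data.Integer.Tactic.RingSolver using (solve-∀)
  open import Data.Product using (∃-syntax; _,_)
  open import Data.Empty using (⊥-elim)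
  open import Relation.Binary.PropositionalEquality
  open ≡-Reasoning

  triangle : ℕ → ℕ
  triangle zero    = zero
  triangle (suc x) = suc x ℕ.+ triangle x

  triangle*2≡x*[1+x] : ∀ x → triangle x ℕ.* 2 ≡ x ℕ.* suc x
  triangle*2≡x*[1+x] zero    = refl
  triangle*2≡x*[1+x] (suc x) = begin
    (suc x ℕ.+ triangle x) ℕ.* 2     ≡⟨ ℕP.*-distribʳ-+ 2 (suc x) (triangle x) ⟩
    suc x ℕ.* 2 ℕ.+ triangle x ℕ.* 2 ≡⟨ cong (suc x ℕ.* 2 ℕ.+_) (triangle*2≡x*[1+x] x) ⟩
    suc x ℕ.* 2 ℕ.+ x ℕ.* suc x      ≡⟨ step x ⟩
    suc x ℕ.* suc (suc x)            ∎
    where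
    step : ∀ x → suc x ℕ.* 2 ℕ.+ x ℕ.* suc x ≡ suc x ℕ.* suc (suc x)
    step = ℕRing.solve-∀

  r*[r-1]-pronic : ∀ r → ∃[ x ] r * (r - 1ℤ) ≡ + (x ℕ.* suc x)
  r*[r-1]-pronic (+ zero)    = 0 , refl
  r*[r-1]-pronic (+ suc a)   = a , (begin
    + suc a * (+ suc a - 1ℤ) ≡⟨ cong (+ suc a *_) (1+a-1≡a a) ⟩
    + suc a * + a            ≡⟨ ℤP.pos-* (suc a) a ⟨
    + (suc a ℕ.* a)          ≡⟨ cong +_ (ℕP.*-comm (suc a) a) ⟩
    + (a ℕ.* suc a)          ∎)
    where
    1+a-1≡a : ∀ a → + suc a - 1ℤ ≡ + a
    1+a-1≡a zero    = refl
    1+a-1≡a (suc _) = refl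
  r*[r-1]-pronic -[1+ a ]    = suc a , e
    where
    e : -[1+ a ] * (-[1+ a ] - 1ℤ) ≡ + (suc a ℕ.* suc (suc a))
    e rewrite ℕP.+-identityʳ a = refl

  binom2*2≡r*[r-1] : ∀ r → binom2 r * + 2 ≡ r * (r - 1ℤ)
  binom2*2≡r*[r-1] r with r*[r-1]-pronic r
  ... | x , e = begin
    + (∣ r * (r - 1ℤ) ∣ ℕD./ 2) * + 2    ≡⟨ cong (λ t → + (∣ t ∣ ℕD./ 2) * + 2) e ⟩
    + ((x ℕ.* suc x) ℕD./ 2) * + 2       ≡⟨ cong (λ t → + (t ℕD./ 2) * + 2) (triangle*2≡x*[1+x] x) ⟨
    + ((triangle x ℕ.* 2) ℕD./ 2) * + 2  ≡⟨ cong (λ t → + t * + 2) (ℕD.m*n/n≡m (triangle x) 2) ⟩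
    + triangle x * + 2                   ≡⟨ ℤP.pos-* (triangle x) 2 ⟨
    + (triangle x ℕ.* 2)                 ≡⟨ cong +_ (triangle*2≡x*[1+x] x) ⟩
    + (x ℕ.* suc x)                      ≡⟨ e ⟨
    r * (r - 1ℤ)                         ∎

  binom2*2-r*[r-1]≡0 : ∀ r → binom2 r * + 2 - r * (r - 1ℤ) ≡ 0ℤ
  binom2*2-r*[r-1]≡0 r = ℤP.i≡j⇒i-j≡0 (binom2*2≡r*[r-1] r)

  IsNat : ℤ → Set
  IsNat i = ∃[ m ] i ≡ + m

  isNat : ∀ m → IsNat (+ m)
  isNat m = m , refl

  isNat-+ : ∀ {i j} → IsNat i → IsNat j → IsNat (i + j)
  isNat-+ (a , refl) (b , refl) = a ℕ.+ b , refl

  isNat-* : ∀ {i j} → IsNat i → IsNat j → IsNat (i * j)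
  isNat-* (a , refl) (b , refl) = a ℕ.* b , sym (ℤP.pos-* a b)

  isNat-binom2 : ∀ r → IsNat (binom2 r)
  isNat-binom2 r = _ , refl

  isNat-∣i∣-i : ∀ i → IsNat (+ ∣ i ∣ - i)
  isNat-∣i∣-i (+ m)    = 0 , ℤP.+-inverseʳ (+ m)
  isNat-∣i∣-i -[1+ m ] = _ , refl

  isNat[j-i]⇒i≤j : ∀ {i j} → IsNat (j - i) → i ℤ.≤ j
  isNat[j-i]⇒i≤j (m , e) = ℤP.0≤i-j⇒j≤i (subst (0ℤ ℤ.≤_) (sym e) (ℤ.+≤+ ℕ.z≤n))

  i*2-j*2≡0⇒i≡j : ∀ i j → i * + 2 - j * + 2 ≡ 0ℤ → i ≡ j
  i*2-j*2≡0⇒i≡j i j h = ℤP.*-cancelʳ-≡ i j (+ 2) (ℤP.i-j≡0⇒i≡j _ _ h)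

  half-*2 : ∀ y → half (y * + 2) ≡ y
  half-*2 y = sym (ℤP.i-j≡0⇒i≡j y h (ℤP.*-cancelʳ-≡ (y - h) 0ℤ (+ 2) [y-h]*2≡0))
    where
    h : ℤ
    h = half (y * + 2)
    r : ℕ
    r = (y * + 2) ℤD.% (+ 2)
    [y-h]*2≡r : (y - h) * + 2 ≡ + r
    [y-h]*2≡r = begin
      (y - h) * + 2                ≡⟨ expand y h (+ r) ⟩
      y * + 2 - (+ r + h * + 2) + + r ≡⟨ cong (λ t → y * + 2 - t + + r) (ℤD.a≡a%n+[a/n]*n (y * + 2) (+ 2)) ⟨
      y * + 2 - y * + 2 + + r      ≡⟨ cancel (y * + 2) (+ r) ⟩
      + r                          ∎
      where
      expand : ∀ y h r → (y - h) * + 2 ≡ y * + 2 - (r + h * + 2) + r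
      expand = solve-∀
      cancel : ∀ a b → a - a + b ≡ b
      cancel = solve-∀
    [y-h]*2≡0 : (y - h) * + 2 ≡ 0ℤ * + 2
    [y-h]*2≡0 with r | ℤD.n%d<d (y * + 2) (+ 2) | [y-h]*2≡r
    ... | zero          | _                  | e = e
    ... | suc zero      | _                  | e = ⊥-elim (z*2≢1 (y - h) e)
      where
      z*2≢1 : ∀ z → z * + 2 ≢ 1ℤ
      z*2≢1 (+ zero)   ()
      z*2≢1 (+ suc n)  e with trans (ℤP.pos-* (suc n) 2) e
      ... | ()
      z*2≢1 -[1+ n ]   ()
    ... | suc (suc _)   | ℕ.s≤s (ℕ.s≤s ()) | _

  signPow : ℕ → ℤ
  signPow zero    = 1ℤ
  signPow (suc n) = - signPow n

  neg1pow≡signPow∣∣ : ∀ t → neg1pow t ≡ signPow ∣ t ∣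
  neg1pow≡signPow∣∣ t = trans (byParity t) (parity ∣ t ∣)
    where
    signOfParity : ℕ → ℤ
    signOfParity zero    = 1ℤ
    signOfParity (suc _) = -1ℤ
    byParity : ∀ t → neg1pow t ≡ signOfParity (∣ t ∣ ℕD.% 2)
    byParity t with ∣ t ∣ ℕD.% 2
    ... | zero  = refl
    ... | suc _ = refl
    parity : ∀ n → signOfParity (n ℕD.% 2) ≡ signPow n
    parity zero          = refl
    parity (suc zero)    = refl
    parity (suc (suc n)) = begin
      signOfParity (suc (suc n) ℕD.% 2) ≡⟨ cong (λ t → signOfParity (t ℕD.% 2)) (ℕP.+-comm 2 n) ⟩
      signOfParity ((n ℕ.+ 2) ℕD.% 2)   ≡⟨ cong signOfParity (ℕD.[m+n]%n≡m%n n 2) ⟩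
      signOfParity (n ℕD.% 2)           ≡⟨ parity n ⟩
      signPow n                         ≡⟨ ℤP.neg-involutive (signPow n) ⟨
      - - signPow n                     ∎

  neg1pow-neg : ∀ t → neg1pow (- t) ≡ neg1pow t
  neg1pow-neg t = begin
    neg1pow (- t)       ≡⟨ neg1pow≡signPow∣∣ (- t) ⟩
    signPow ∣ - t ∣     ≡⟨ cong signPow (ℤP.∣-i∣≡∣i∣ t) ⟩
    signPow ∣ t ∣       ≡⟨ neg1pow≡signPow∣∣ t ⟨
    neg1pow t           ∎

  neg1pow-suc : ∀ t → neg1pow (t + 1ℤ) ≡ - neg1pow t
  neg1pow-suc t = begin
    neg1pow (t + 1ℤ)      ≡⟨ neg1pow≡signPow∣∣ (t + 1ℤ) ⟩
    signPow ∣ t + 1ℤ ∣    ≡⟨ flips t ⟩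
    - signPow ∣ t ∣       ≡⟨ cong -_ (neg1pow≡signPow∣∣ t) ⟨
    - neg1pow t           ∎
    where
    flips : ∀ t → signPow ∣ t + 1ℤ ∣ ≡ - signPow ∣ t ∣
    flips (+ n)           = cong signPow (trans (cong ∣_∣ (sym (ℤP.pos-+ n 1))) (ℕP.+-comm n 1))
    flips -[1+ zero ]     = refl
    flips -[1+ suc m ]    = sym (ℤP.neg-involutive (- signPow m))

  neg1pow-+*2 : ∀ t q → neg1pow (t + q * + 2) ≡ neg1pow t
  neg1pow-+*2 t (+ m)    = shiftUp t m
    where
    twice : ∀ t → neg1pow (t + 1ℤ + 1ℤ) ≡ neg1pow t
    twice t = trans (neg1pow-suc (t + 1ℤ)) (trans (cong -_ (neg1pow-suc t)) (ℤP.neg-involutive _))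
    shiftUp : ∀ t m → neg1pow (t + + m * + 2) ≡ neg1pow t
    shiftUp t zero    = cong neg1pow (ℤP.+-identityʳ t)
    shiftUp t (suc m) = trans (cong neg1pow (reassoc t (+ m))) (trans (twice (t + + m * + 2)) (shiftUp t m))
      where
      reassoc : ∀ t m → t + (1ℤ + m) * + 2 ≡ t + m * + 2 + 1ℤ + 1ℤ
      reassoc = solve-∀
  neg1pow-+*2 t -[1+ m ] = sym (trans (cong neg1pow (undo t -[1+ m ])) (neg1pow-+*2 (t + -[1+ m ] * + 2) (+ suc m)))
    where
    undo : ∀ t q → t ≡ t + q * + 2 + (- q) * + 2
    undo = solve-∀

module IntervalSum where

  open import Data.Nat as ℕ using (ℕ; zero; suc)
  import Data.Nat.Properties as ℕP
  import Data.Nat.Tactic.RingSolver as ℕRing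
  open import Data.Integer using (ℤ; +_; -[1+_]; _+_; _*_; _-_; -_; 0ℤ; 1ℤ)
  import Data.Integer.Properties as ℤP
  open import Data.Integer.Tactic.RingSolver using (solve-∀)
  open import Data.Product using (∃-syntax; _×_; _,_)
  open import Data.Sum using (_⊎_; inj₁; inj₂)
  open import Relation.Nullary using (yes; no)
  open import Relation.Binary.PropositionalEquality
  open ≡-Reasoning

  sumFrom : ℤ → ℕ → (ℤ → ℤ) → ℤ
  sumFrom a zero    g = 0ℤ
  sumFrom a (suc n) g = g a + sumFrom (a + 1ℤ) n g

  sumFrom-cong : ∀ a n {g h : ℤ → ℤ} → (∀ i → g i ≡ h i) → sumFrom a n g ≡ sumFrom a n h
  sumFrom-cong a zero    e = refl
  sumFrom-cong a (suc n) e = cong₂ _+_ (e a) (sumFrom-cong (a + 1ℤ) n e)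

  sumFrom-zero : ∀ a n (g : ℤ → ℤ) → (∀ i → g i ≡ 0ℤ) → sumFrom a n g ≡ 0ℤ
  sumFrom-zero a zero    g e = refl
  sumFrom-zero a (suc n) g e = cong₂ _+_ (e a) (sumFrom-zero (a + 1ℤ) n g e)

  sumFrom-+ : ∀ a n (g h : ℤ → ℤ) → sumFrom a n (λ i → g i + h i) ≡ sumFrom a n g + sumFrom a n h
  sumFrom-+ a zero    g h = refl
  sumFrom-+ a (suc n) g h =
    trans (cong (_+_ (g a + h a)) (sumFrom-+ (a + 1ℤ) n g h)) (interchange (g a) (h a) _ _)
    where
    interchange : ∀ x y z w → x + y + (z + w) ≡ x + z + (y + w)
    interchange = solve-∀

  sumFrom-neg : ∀ a n (g : ℤ → ℤ) → sumFrom a n (λ i → - g i) ≡ - sumFrom a n g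
  sumFrom-neg a zero    g = refl
  sumFrom-neg a (suc n) g =
    trans (cong (_+_ (- g a)) (sumFrom-neg (a + 1ℤ) n g)) (sym (ℤP.neg-distrib-+ (g a) _))

  sumFrom-+- : ∀ a n (f g h : ℤ → ℤ) →
    sumFrom a n (λ i → f i + g i - h i) ≡ sumFrom a n f + sumFrom a n g - sumFrom a n h
  sumFrom-+- a n f g h = trans (sumFrom-+ a n (λ i → f i + g i) (λ i → - h i))
    (cong₂ _+_ (sumFrom-+ a n f g) (sumFrom-neg a n h))

  sumFrom-comm : ∀ a n b m (G : ℤ → ℤ → ℤ) →
    sumFrom a n (λ i → sumFrom b m (G i)) ≡ sumFrom b m (λ j → sumFrom a n (λ i → G i j))
  sumFrom-comm a zero    b m G = sym (sumFrom-zero b m _ (λ _ → refl))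
  sumFrom-comm a (suc n) b m G = trans (cong (_+_ (sumFrom b m (G a))) (sumFrom-comm (a + 1ℤ) n b m G))
    (sym (sumFrom-+ b m (G a) (λ j → sumFrom (a + 1ℤ) n (λ i → G i j))))

  sumFrom-++ : ∀ a m n (g : ℤ → ℤ) → sumFrom a (m ℕ.+ n) g ≡ sumFrom a m g + sumFrom (a + + m) n g
  sumFrom-++ a zero    n g = trans (cong (λ t → sumFrom t n g) (sym (ℤP.+-identityʳ a))) (sym (ℤP.+-identityˡ _))
  sumFrom-++ a (suc m) n g = begin
    g a + sumFrom (a + 1ℤ) (m ℕ.+ n) g
      ≡⟨ cong (_+_ (g a)) (sumFrom-++ (a + 1ℤ) m n g) ⟩
    g a + (sumFrom (a + 1ℤ) m g + sumFrom (a + 1ℤ + + m) n g)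
      ≡⟨ cong (λ t → g a + (sumFrom (a + 1ℤ) m g + sumFrom t n g)) (ℤP.+-assoc a 1ℤ (+ m)) ⟩
    g a + (sumFrom (a + 1ℤ) m g + sumFrom (a + + suc m) n g)
      ≡⟨ ℤP.+-assoc (g a) _ _ ⟨
    g a + sumFrom (a + 1ℤ) m g + sumFrom (a + + suc m) n g ∎

  sumFrom-snoc : ∀ a n (g : ℤ → ℤ) → sumFrom a (suc n) g ≡ sumFrom a n g + g (a + + n)
  sumFrom-snoc a n g = begin
    sumFrom a (suc n) g                    ≡⟨ cong (λ t → sumFrom a t g) (ℕP.+-comm 1 n) ⟩
    sumFrom a (n ℕ.+ 1) g                  ≡⟨ sumFrom-++ a n 1 g ⟩
    sumFrom a n g + (g (a + + n) + 0ℤ)     ≡⟨ cong (_+_ (sumFrom a n g)) (ℤP.+-identityʳ _) ⟩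
    sumFrom a n g + g (a + + n)            ∎

  sumFrom-shift : ∀ a n c (g : ℤ → ℤ) → sumFrom a n (λ i → g (i + c)) ≡ sumFrom (a + c) n g
  sumFrom-shift a zero    c g = refl
  sumFrom-shift a (suc n) c g = cong (_+_ (g (a + c)))
    (trans (sumFrom-shift (a + 1ℤ) n c g) (cong (λ t → sumFrom t n g) (swap a c)))
    where
    swap : ∀ a c → a + 1ℤ + c ≡ a + c + 1ℤ
    swap = solve-∀

  sumFrom-reflect : ∀ a n (g : ℤ → ℤ) → sumFrom a n (λ i → g (- i)) ≡ sumFrom (- (a + + n) + 1ℤ) n g
  sumFrom-reflect a zero    g = refl
  sumFrom-reflect a (suc n) g = begin
    g (- a) + sumFrom (a + 1ℤ) n (λ i → g (- i))   ≡⟨ cong (_+_ (g (- a))) (sumFrom-reflect (a + 1ℤ) n g) ⟩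
    g (- a) + sumFrom (- (a + 1ℤ + + n) + 1ℤ) n g  ≡⟨ cong (λ t → g (- a) + sumFrom (- t + 1ℤ) n g) (ℤP.+-assoc a 1ℤ (+ n)) ⟩
    g (- a) + sumFrom b n g                        ≡⟨ ℤP.+-comm (g (- a)) _ ⟩
    sumFrom b n g + g (- a)                        ≡⟨ cong (λ t → sumFrom b n g + g t) (last a (+ n)) ⟩
    sumFrom b n g + g (b + + n)                    ≡⟨ sumFrom-snoc b n g ⟨
    sumFrom b (suc n) g                            ∎
    where
    b : ℤ
    b = - (a + + suc n) + 1ℤ
    last : ∀ a n → - a ≡ - (a + (1ℤ + n)) + 1ℤ + n
    last = solve-∀

  sumFrom-evenOdd : ∀ a n (g : ℤ → ℤ) →
    sumFrom (a * + 2) (n ℕ.+ n) g ≡ sumFrom a n (λ i → g (i * + 2)) + sumFrom a n (λ i → g (i * + 2 + 1ℤ))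
  sumFrom-evenOdd a zero    g = refl
  sumFrom-evenOdd a (suc n) g = begin
    sumFrom (a * + 2) (suc n ℕ.+ suc n) g
      ≡⟨ cong (λ t → sumFrom (a * + 2) (suc t) g) (ℕP.+-suc n n) ⟩
    g (a * + 2) + (g (a * + 2 + 1ℤ) + sumFrom (a * + 2 + 1ℤ + 1ℤ) (n ℕ.+ n) g)
      ≡⟨ cong (λ t → g (a * + 2) + (g (a * + 2 + 1ℤ) + sumFrom t (n ℕ.+ n) g)) (next a) ⟩
    g (a * + 2) + (g (a * + 2 + 1ℤ) + sumFrom ((a + 1ℤ) * + 2) (n ℕ.+ n) g)
      ≡⟨ cong (λ t → g (a * + 2) + (g (a * + 2 + 1ℤ) + t)) (sumFrom-evenOdd (a + 1ℤ) n g) ⟩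
    g (a * + 2) + (g (a * + 2 + 1ℤ) + (evens + odds))
      ≡⟨ interchange (g (a * + 2)) (g (a * + 2 + 1ℤ)) evens odds ⟩
    (g (a * + 2) + evens) + (g (a * + 2 + 1ℤ) + odds) ∎
    where
    evens odds : ℤ
    evens = sumFrom (a + 1ℤ) n (λ i → g (i * + 2))
    odds  = sumFrom (a + 1ℤ) n (λ i → g (i * + 2 + 1ℤ))
    next : ∀ a → a * + 2 + 1ℤ + 1ℤ ≡ (a + 1ℤ) * + 2
    next = solve-∀
    interchange : ∀ x y z w → x + (y + (z + w)) ≡ (x + z) + (y + w)
    interchange = solve-∀

  sumFrom-zeroOn : ∀ a n (g : ℤ → ℤ) → (∀ m → m ℕ.< n → g (a + + m) ≡ 0ℤ) → sumFrom a n g ≡ 0ℤ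
  sumFrom-zeroOn a zero    g e = refl
  sumFrom-zeroOn a (suc n) g e =
    cong₂ _+_ (trans (cong g (sym (ℤP.+-identityʳ a))) (e 0 (ℕ.s≤s ℕ.z≤n)))
              (sumFrom-zeroOn (a + 1ℤ) n g (λ m m<n → trans (cong g (ℤP.+-assoc a 1ℤ (+ m))) (e (suc m) (ℕ.s≤s m<n))))

  symSum : ℕ → (ℤ → ℤ) → ℤ
  symSum M g = sumFrom (- + M) (suc (M ℕ.+ M)) g

  -- ∣ i ∣ > M and ∣ i ∣ ≤ M, in a witness form that the ring solver can consume.
  Outside : ℕ → ℤ → Set
  Outside M i = (∃[ d ] i ≡ + M + 1ℤ + + d) ⊎ (∃[ d ] i ≡ - + M - 1ℤ - + d)

  Inside : ℕ → ℤ → Set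
  Inside M i = ∃[ v ] ∃[ v′ ] (v ℕ.+ v′ ≡ M ℕ.+ M) × (i ≡ + v - + M)

  SupportedIn : ℕ → (ℤ → ℤ) → Set
  SupportedIn M g = ∀ i → Outside M i → g i ≡ 0ℤ

  inside⊎outside : ∀ M i → Inside M i ⊎ Outside M i
  inside⊎outside M (+ k) with k ℕP.≤? M
  ... | yes k≤M with ℕP.m≤n⇒∃[o]m+o≡n k≤M
  ...   | t , k+t≡M = inj₁ (M ℕ.+ k , t , trans (ℕP.+-assoc M k t) (cong (M ℕ.+_) k+t≡M) ,
                           trans (addSub (+ k) (+ M)) (cong (_- + M) (sym (ℤP.pos-+ M k))))
    where
    addSub : ∀ k M → k ≡ M + k - M
    addSub = solve-∀
  inside⊎outside M (+ k) | no k≰M with ℕP.m≤n⇒∃[o]m+o≡n (ℕP.≰⇒> k≰M)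
  ...   | d , refl = inj₂ (inj₁ (d , trans (ℤP.pos-+ (suc M) d) (cong (_+ + d) (ℤP.+-comm 1ℤ (+ M)))))
  inside⊎outside M -[1+ k ] with suc k ℕP.≤? M
  ... | yes k<M with ℕP.m≤n⇒∃[o]m+o≡n k<M
  ...   | t , refl = inj₁ (t , suc k ℕ.+ t ℕ.+ suc k , ℕ-shuffle k t ,
                           trans (negSuc (+ k) (+ t)) (cong (_-_ (+ t)) (sym (ℤP.pos-+ (suc k) t))))
    where
    ℕ-shuffle : ∀ k t → t ℕ.+ (suc k ℕ.+ t ℕ.+ suc k) ≡ suc k ℕ.+ t ℕ.+ (suc k ℕ.+ t)
    ℕ-shuffle = ℕRing.solve-∀
    negSuc : ∀ k t → - (1ℤ + k) ≡ t - (1ℤ + k + t)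
    negSuc = solve-∀
  inside⊎outside M -[1+ k ] | no k≮M with ℕP.m≤n⇒∃[o]m+o≡n (ℕP.≤-pred (ℕP.≰⇒> k≮M))
  ...   | d , refl = inj₂ (inj₂ (d , trans (cong (λ z → - (1ℤ + z)) (ℤP.pos-+ M d)) (negSuc (+ M) (+ d))))
    where
    negSuc : ∀ M d → - (1ℤ + (M + d)) ≡ - M - 1ℤ - d
    negSuc = solve-∀

  sumFrom-window : ∀ M (g : ℤ → ℤ) → SupportedIn M g → ∀ a m d e →
    a ≡ - + M - + d → m ≡ d ℕ.+ (suc (M ℕ.+ M) ℕ.+ e) → sumFrom a m g ≡ symSum M g
  sumFrom-window M g supp .(- + M - + d) .(d ℕ.+ (suc (M ℕ.+ M) ℕ.+ e)) d e refl refl = begin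
    sumFrom a (d ℕ.+ (X ℕ.+ e)) g                              ≡⟨ sumFrom-++ a d (X ℕ.+ e) g ⟩
    sumFrom a d g + sumFrom (a + + d) (X ℕ.+ e) g              ≡⟨ cong₂ _+_ below (sumFrom-++ (a + + d) X e g) ⟩
    0ℤ + (sumFrom (a + + d) X g + sumFrom (a + + d + + X) e g) ≡⟨ cong (λ t → 0ℤ + (sumFrom (a + + d) X g + t)) above ⟩
    0ℤ + (sumFrom (a + + d) X g + 0ℤ)                          ≡⟨ cong (λ t → 0ℤ + (sumFrom t X g + 0ℤ)) (subAdd (+ M) (+ d)) ⟩
    0ℤ + (symSum M g + 0ℤ)                                     ≡⟨ units _ ⟩
    symSum M g                                                 ∎
    where
    a : ℤ
    a = - + M - + d
    X : ℕ
    X = suc (M ℕ.+ M)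
    subAdd : ∀ m d → - m - d + d ≡ - m
    subAdd = solve-∀
    units : ∀ x → 0ℤ + (x + 0ℤ) ≡ x
    units = solve-∀
    below : sumFrom a d g ≡ 0ℤ
    below = sumFrom-zeroOn a d g λ m m<d → outside m (ℕP.m≤n⇒∃[o]m+o≡n m<d)
      where
      reach : ∀ M m t → - M - (1ℤ + m + t) + m ≡ - M - 1ℤ - t
      reach = solve-∀
      outside : ∀ m → ∃[ t ] suc m ℕ.+ t ≡ d → g (a + + m) ≡ 0ℤ
      outside m (t , refl) = supp _ (inj₂ (t ,
        trans (cong (λ z → - + M - z + + m) (ℤP.pos-+ (suc m) t)) (reach (+ M) (+ m) (+ t))))
    above : sumFrom (a + + d + + X) e g ≡ 0ℤ
    above = sumFrom-zeroOn _ e g λ m _ → supp _ (inj₁ (m ,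
      trans (cong (λ z → a + + d + (1ℤ + z) + + m) (ℤP.pos-+ M M)) (reach (+ M) (+ d) (+ m))))
      where
      reach : ∀ M d m → - M - d + d + (1ℤ + (M + M)) + m ≡ M + 1ℤ + m
      reach = solve-∀

  outside⁺⇒< : ∀ M a → Outside M (+ a) → M ℕ.< a
  outside⁺⇒< M a (inj₁ (d , e)) =
    subst (M ℕ.<_) (sym (ℤP.+-injective e)) (ℕP.≤-trans (ℕP.≤-reflexive (ℕP.+-comm 1 M)) (ℕP.m≤m+n (M ℕ.+ 1) d))
  outside⁺⇒< M a (inj₂ (d , e)) with trans e (negSuc (+ M) (+ d))
    where
    negSuc : ∀ M d → - M - 1ℤ - d ≡ - (1ℤ + (M + d))
    negSuc = solve-∀
  ... | ()

  outside⁻⇒≤ : ∀ M a → Outside M -[1+ a ] → M ℕ.≤ a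
  outside⁻⇒≤ M a (inj₁ (d , ()))
  outside⁻⇒≤ M a (inj₂ (d , e)) with trans e (negSuc (+ M) (+ d))
    where
    negSuc : ∀ M d → - M - 1ℤ - d ≡ - (1ℤ + (M + d))
    negSuc = solve-∀
  ... | refl = ℕP.m≤m+n M d

  outside-*2 : ∀ M j → Outside M j → Outside M (j * + 2)
  outside-*2 M j (inj₁ (d , refl)) = inj₁ (M ℕ.+ 1 ℕ.+ d ℕ.+ d , double (+ M) (+ d))
    where
    double : ∀ M d → (M + 1ℤ + d) * + 2 ≡ M + 1ℤ + (M + 1ℤ + d + d)
    double = solve-∀
  outside-*2 M j (inj₂ (d , refl)) = inj₂ (M ℕ.+ 1 ℕ.+ d ℕ.+ d , double (+ M) (+ d))
    where
    double : ∀ M d → (- M - 1ℤ - d) * + 2 ≡ - M - 1ℤ - (M + 1ℤ + d + d)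
    double = solve-∀

  outside-1-*2 : ∀ M k → Outside M k → Outside M (1ℤ - k * + 2)
  outside-1-*2 M k (inj₁ (d , refl)) = inj₂ (M ℕ.+ d ℕ.+ d , odd (+ M) (+ d))
    where
    odd : ∀ M d → 1ℤ - (M + 1ℤ + d) * + 2 ≡ - M - 1ℤ - (M + d + d)
    odd = solve-∀
  outside-1-*2 M k (inj₂ (d , refl)) = inj₁ (M ℕ.+ 2 ℕ.+ d ℕ.+ d , odd (+ M) (+ d))
    where
    odd : ∀ M d → 1ℤ - (- M - 1ℤ - d) * + 2 ≡ M + 1ℤ + (M + + 2 + d + d)
    odd = solve-∀

module BoxSum where

  open IntervalSum
  open import Data.Nat as ℕ using (ℕ; zero; suc)
  open import Data.Integer using (ℤ; +_; _+_; _-_; -_; 1ℤ)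
  import Data.Integer.Properties as ℤP
  open import Data.List using (List; []; _∷_; map; _++_; applyUpTo; concatMap)
  open import Relation.Binary.PropositionalEquality
  open ≡-Reasoning

  sumℤ-++ : ∀ xs ys → sumℤ (xs ++ ys) ≡ sumℤ xs + sumℤ ys
  sumℤ-++ []       ys = sym (ℤP.+-identityˡ _)
  sumℤ-++ (x ∷ xs) ys = trans (cong (_+_ x) (sumℤ-++ xs ys)) (sym (ℤP.+-assoc x _ _))

  sumℤ-concatMap : ∀ {A : Set} (F : A → List ℤ) xs →
    sumℤ (concatMap F xs) ≡ sumℤ (map (λ x → sumℤ (F x)) xs)
  sumℤ-concatMap F []       = refl
  sumℤ-concatMap F (x ∷ xs) =
    trans (sumℤ-++ (F x) (concatMap F xs)) (cong (_+_ (sumℤ (F x))) (sumℤ-concatMap F xs))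

  sumℤ-box : ∀ B g → sumℤ (map g (box B)) ≡ symSum B g
  sumℤ-box B g = go (suc (B ℕ.+ B)) (λ i → i) (- + B) (λ i → ℤP.+-comm (+ i) (- + B))
    where
    go : ∀ n (f : ℕ → ℕ) a → (∀ i → + f i - + B ≡ a + + i) →
      sumℤ (map g (map (λ i → + i - + B) (applyUpTo f n))) ≡ sumFrom a n g
    go zero    f a h = refl
    go (suc n) f a h = cong₂ _+_ (cong g (trans (h 0) (ℤP.+-identityʳ a)))
      (go n (λ i → f (suc i)) (a + 1ℤ) (λ i → trans (h (suc i)) (sym (ℤP.+-assoc a 1ℤ (+ i)))))

  boxSum≡symSum² : ∀ B (G : ℤ → ℤ → ℤ) → boxSum B G ≡ symSum B (λ r → symSum B (G r))
  boxSum≡symSum² B G = begin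
    sumℤ (concatMap (λ r → map (G r) (box B)) (box B)) ≡⟨ sumℤ-concatMap (λ r → map (G r) (box B)) (box B) ⟩
    sumℤ (map (λ r → sumℤ (map (G r) (box B))) (box B)) ≡⟨ sumℤ-box B (λ r → sumℤ (map (G r) (box B))) ⟩
    symSum B (λ r → sumℤ (map (G r) (box B)))           ≡⟨ sumFrom-cong (- + B) (suc (B ℕ.+ B)) (λ r → sumℤ-box B (G r)) ⟩
    symSum B (λ r → symSum B (G r))                     ∎

module QuadraticGrowth where

  open import Data.Nat
  open import Data.Nat.Properties
  open import Data.Nat.Tactic.RingSolver using (solve-∀)
  open import Data.Product using (_,_)
  open import Data.Sum using (inj₁; inj₂)
  open import Relation.Nullary using (yes; no)
  open import Data.Empty using (⊥-elim)
  open import Relation.Binary.PropositionalEquality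

  -- If a exceeds N + L * L + L, then a * (a - L) alone exceeds N + L * L, while b * (b - L) ≥ - L * L.
  a*a+b*b≤N+L*[a+b]⇒a≤N+L*L+L : ∀ N L a b → a * a + b * b ≤ N + L * (a + b) → a ≤ N + L * L + L
  a*a+b*b≤N+L*[a+b]⇒a≤N+L*L+L N L a b h with a ≤? N + L * L + L
  ... | yes a≤X = a≤X
  ... | no a≰X with m≤n⇒∃[o]m+o≡n (≰⇒> a≰X) | ≤-total b L
  ...   | t , refl | inj₁ b≤L with m≤n⇒∃[o]m+o≡n b≤L
  ...     | v , refl = ⊥-elim (m+1+n≰m _ (subst (_≤ N + L * (a + b)) (small-b N b v t) h))
    where
    small-b : ∀ N b v t → let L = b + v ; a = suc (N + L * L + L + t) in
      a * a + b * b ≡ N + L * (a + b) + (1 +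
        ((N + L * L + L + t) + (N + L * L + L + t) * N + a * b * b + (a + (N + L * L + L) + t) * b * v + a * v * v + a * t))
    small-b = solve-∀
  a*a+b*b≤N+L*[a+b]⇒a≤N+L*L+L N L a b h | no a≰X | t , refl | inj₂ L≤b with m≤n⇒∃[o]m+o≡n L≤b
  ...     | u , refl = ⊥-elim (m+1+n≰m _ (subst (_≤ N + L * (a + b)) (large-b N L u t) h))
    where
    large-b : ∀ N L u t → let b = L + u ; a = suc (N + L * L + L + t) in
      a * a + b * b ≡ N + L * (a + b) + (1 + ((N + L * L + L + t) + (N + L * L + L + t) * N + a * L * L + a * t + (L + u) * u))
    large-b = solve-∀

  a*a+b*b≤N+L*[a+b]⇒b≤N+L*L+L : ∀ N L a b → a * a + b * b ≤ N + L * (a + b) → b ≤ N + L * L + L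
  a*a+b*b≤N+L*[a+b]⇒b≤N+L*L+L N L a b h = a*a+b*b≤N+L*[a+b]⇒a≤N+L*L+L N L b a
    (subst₂ _≤_ (+-comm (a * a) (b * b)) (cong (λ z → N + L * z) (+-comm a b)) h)

module Signs where

  open Arithmetic using (neg1pow-neg)
  open import Data.Nat as ℕ using (ℕ; zero; suc)
  import Data.Nat.Properties as ℕP
  open import Data.Integer using (ℤ; +_; -[1+_]; _+_; _*_; _-_; -_; 0ℤ; 1ℤ; _≤?_)
  open import Data.Integer.Tactic.RingSolver using (solve-∀)
  open import Data.Bool using (Bool; _∧_; if_then_else_)
  open import Data.Product using (_,_)
  open import Relation.Nullary using (yes; no)
  open import Relation.Nullary.Decidable using (does)
  open import Relation.Binary.PropositionalEquality

  signed : Bool → Bool → ℤ → ℤ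
  signed b₁ b₂ P = if b₁ then P else if b₂ then - P else 0ℤ

  quadrantSign : ℤ → ℤ → ℤ → ℤ
  quadrantSign r s = signed (nonneg r ∧ nonneg s) (neg r ∧ neg s)

  fWeight : ℤ → ℤ → ℤ
  fWeight r s = quadrantSign r s (neg1pow (r + s))

  stringWeight : ℤ → ℤ → ℤ
  stringWeight j k =
    signed (does (1ℤ ≤? j) ∧ does (k ≤? 0ℤ)) (does (j ≤? 0ℤ) ∧ does (1ℤ ≤? k)) (neg1pow (k - j))

  axisWeight : ℤ → ℤ → ℤ
  axisWeight (+ zero)  k = neg1pow (k - + 0)
  axisWeight (+ suc _) k = 0ℤ
  axisWeight -[1+ _ ]  k = 0ℤ

  r₁ s₁ r₂ s₂ : ℤ → ℤ → ℤ
  r₁ j k = j * + 2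
  s₁ j k = - j - k
  r₂ j k = 1ℤ - k * + 2
  s₂ j k = j + k - 1ℤ

  fWeight-r₁s₁ : ∀ j k → fWeight (r₁ j k) (s₁ j k) ≡ quadrantSign (r₁ j k) (s₁ j k) (neg1pow (k - j))
  fWeight-r₁s₁ j k = cong (quadrantSign (r₁ j k) (s₁ j k)) (trans (cong neg1pow (e j k)) (neg1pow-neg (k - j)))
    where
    e : ∀ j k → j * + 2 + (- j - k) ≡ - (k - j)
    e = solve-∀

  fWeight-r₂s₂ : ∀ j k → fWeight (r₂ j k) (s₂ j k) ≡ quadrantSign (r₂ j k) (s₂ j k) (neg1pow (k - j))
  fWeight-r₂s₂ j k = cong (quadrantSign (r₂ j k) (s₂ j k)) (trans (cong neg1pow (e j k)) (neg1pow-neg (k - j)))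
    where
    e : ∀ j k → 1ℤ - k * + 2 + (j + k - 1ℤ) ≡ - (k - j)
    e = solve-∀

  QuadrantSplit : ℤ → ℤ → ℤ → ℤ → ℤ → ℤ → Set
  QuadrantSplit j k r s r′ s′ =
    stringWeight j k ≡ quadrantSign r s (neg1pow (k - j)) + quadrantSign r′ s′ (neg1pow (k - j)) - axisWeight j k

  Splits : ℤ → ℤ → Set
  Splits j k = QuadrantSplit j k (r₁ j k) (s₁ j k) (r₂ j k) (s₂ j k)

  via : ∀ j k r s r′ s′ → r₁ j k ≡ r → s₁ j k ≡ s → r₂ j k ≡ r′ → s₂ j k ≡ s′ →
    QuadrantSplit j k r s r′ s′ → Splits j k
  via _ _ _ _ _ _ refl refl refl refl h = h

  x≡x+0-0 : ∀ x → x ≡ x + 0ℤ - 0ℤ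
  x≡x+0-0 = solve-∀
  x≡0+x-0 : ∀ x → x ≡ 0ℤ + x - 0ℤ
  x≡0+x-0 = solve-∀
  -x≡-x+0-0 : ∀ x → - x ≡ - x + 0ℤ - 0ℤ
  -x≡-x+0-0 = solve-∀
  -x≡0+-x-0 : ∀ x → - x ≡ 0ℤ + - x - 0ℤ
  -x≡0+-x-0 = solve-∀
  -x≡0+0-x : ∀ x → - x ≡ 0ℤ + 0ℤ - x
  -x≡0+0-x = solve-∀
  0≡x+0-x : ∀ x → 0ℤ ≡ x + 0ℤ - x
  0≡x+0-x = solve-∀

  -- Case analysis on the signs of j, k and j + k; in each case r₁ s₁ r₂ s₂ are first rewritten
  -- to constructor form, after which all the sign tests compute.
  quadrantSplit⁰ : ∀ k → Splits (+ 0) k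
  quadrantSplit⁰ (+ zero) = refl
  quadrantSplit⁰ (+ suc b) =
    via (+ zero) (+ suc b) (+ 0) -[1+ b ] -[1+ (b ℕ.+ b) ] (+ b) refl (e₁ (+ b)) (e₂ (+ b)) (e₃ (+ b)) (-x≡0+0-x (neg1pow ((+ suc b) - (+ zero))))
    where
    e₁ : ∀ B → - + 0 - (1ℤ + B) ≡ - (1ℤ + B)
    e₁ = solve-∀
    e₂ : ∀ B → 1ℤ - (1ℤ + B) * + 2 ≡ - (1ℤ + (B + B))
    e₂ = solve-∀
    e₃ : ∀ B → + 0 + (1ℤ + B) - 1ℤ ≡ B
    e₃ = solve-∀
  quadrantSplit⁰ -[1+ b ] =
    via (+ zero) -[1+ b ] (+ 0) (+ suc b) (+ 3 + (+ b + + b)) -[1+ suc b ] refl (e₁ (+ b)) (e₂ (+ b)) (e₃ (+ b)) (0≡x+0-x (neg1pow (-[1+ b ] - (+ zero))))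
    where
    e₁ : ∀ B → - + 0 - - (1ℤ + B) ≡ 1ℤ + B
    e₁ = solve-∀
    e₂ : ∀ B → 1ℤ - - (1ℤ + B) * + 2 ≡ + 3 + (B + B)
    e₂ = solve-∀
    e₃ : ∀ B → + 0 + - (1ℤ + B) - 1ℤ ≡ - (1ℤ + (1ℤ + B))
    e₃ = solve-∀
  quadrantSplit⁺ : ∀ a k → Splits (+ suc a) k
  quadrantSplit⁺ a (+ zero) =
    via (+ suc a) (+ zero) (+ 2 + (+ a + + a)) -[1+ a ] 1ℤ (+ a) (e₁ (+ a)) (e₂ (+ a)) refl (e₄ (+ a)) (x≡0+x-0 (neg1pow ((+ zero) - (+ suc a))))
    where
    e₁ : ∀ A → (1ℤ + A) * + 2 ≡ + 2 + (A + A)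
    e₁ = solve-∀
    e₂ : ∀ A → - (1ℤ + A) - + 0 ≡ - (1ℤ + A)
    e₂ = solve-∀
    e₄ : ∀ A → (1ℤ + A) + + 0 - 1ℤ ≡ A
    e₄ = solve-∀
  quadrantSplit⁺ a (+ suc b) =
    via (+ suc a) (+ suc b) (+ 2 + (+ a + + a)) -[1+ suc (a ℕ.+ b) ] -[1+ (b ℕ.+ b) ] (+ suc (a ℕ.+ b))
      (e₁ (+ a)) (e₂ (+ a) (+ b)) (e₃ (+ b)) (e₄ (+ a) (+ b)) refl
    where
    e₁ : ∀ A → (1ℤ + A) * + 2 ≡ + 2 + (A + A)
    e₁ = solve-∀
    e₂ : ∀ A B → - (1ℤ + A) - (1ℤ + B) ≡ - (1ℤ + (1ℤ + (A + B)))
    e₂ = solve-∀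
    e₃ : ∀ B → 1ℤ - (1ℤ + B) * + 2 ≡ - (1ℤ + (B + B))
    e₃ = solve-∀
    e₄ : ∀ A B → (1ℤ + A) + (1ℤ + B) - 1ℤ ≡ 1ℤ + (A + B)
    e₄ = solve-∀
  quadrantSplit⁺ a -[1+ b ] with a ℕP.≤? b
  ... | yes a≤b with ℕP.m≤n⇒∃[o]m+o≡n a≤b
  ...   | d , refl =
    via (+ suc a) -[1+ (a ℕ.+ d) ] (+ 2 + (+ a + + a)) (+ d) (+ 3 + ((+ a + + d) + (+ a + + d))) -[1+ d ]
      (e₁ (+ a)) (e₂ (+ a) (+ d)) (e₃ (+ a) (+ d)) (e₄ (+ a) (+ d)) (x≡x+0-0 (neg1pow (-[1+ (a ℕ.+ d) ] - (+ suc a))))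
    where
    e₁ : ∀ A → (1ℤ + A) * + 2 ≡ + 2 + (A + A)
    e₁ = solve-∀
    e₂ : ∀ A D → - (1ℤ + A) - - (1ℤ + (A + D)) ≡ D
    e₂ = solve-∀
    e₃ : ∀ A D → 1ℤ - - (1ℤ + (A + D)) * + 2 ≡ + 3 + ((A + D) + (A + D))
    e₃ = solve-∀
    e₄ : ∀ A D → (1ℤ + A) + - (1ℤ + (A + D)) - 1ℤ ≡ - (1ℤ + D)
    e₄ = solve-∀
  quadrantSplit⁺ a -[1+ b ] | no a≰b with ℕP.m≤n⇒∃[o]m+o≡n (ℕP.≰⇒> a≰b)
  ...   | d , refl =
    via (+ suc (suc (b ℕ.+ d))) -[1+ b ] (+ 4 + ((+ b + + d) + (+ b + + d))) -[1+ d ] (+ 3 + (+ b + + b)) (+ d)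
      (e₁ (+ b) (+ d)) (e₂ (+ b) (+ d)) (e₃ (+ b)) (e₄ (+ b) (+ d)) (x≡0+x-0 (neg1pow (-[1+ b ] - (+ suc (suc (b ℕ.+ d))))))
    where
    e₁ : ∀ B D → (1ℤ + (1ℤ + (B + D))) * + 2 ≡ + 4 + ((B + D) + (B + D))
    e₁ = solve-∀
    e₂ : ∀ B D → - (1ℤ + (1ℤ + (B + D))) - - (1ℤ + B) ≡ - (1ℤ + D)
    e₂ = solve-∀
    e₃ : ∀ B → 1ℤ - - (1ℤ + B) * + 2 ≡ + 3 + (B + B)
    e₃ = solve-∀
    e₄ : ∀ B D → (1ℤ + (1ℤ + (B + D))) + - (1ℤ + B) - 1ℤ ≡ D
    e₄ = solve-∀
  quadrantSplit⁻ : ∀ a k → Splits -[1+ a ] k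
  quadrantSplit⁻ a (+ zero) =
    via -[1+ a ] (+ zero) (- (1ℤ + (1ℤ + (+ a + + a)))) (+ suc a) 1ℤ -[1+ suc a ] (e₁ (+ a)) (e₂ (+ a)) refl (e₄ (+ a)) refl
    where
    e₁ : ∀ A → - (1ℤ + A) * + 2 ≡ - (1ℤ + (1ℤ + (A + A)))
    e₁ = solve-∀
    e₂ : ∀ A → - - (1ℤ + A) - + 0 ≡ 1ℤ + A
    e₂ = solve-∀
    e₄ : ∀ A → - (1ℤ + A) + + 0 - 1ℤ ≡ - (1ℤ + (1ℤ + A))
    e₄ = solve-∀
  quadrantSplit⁻ a -[1+ b ] =
    via -[1+ a ] -[1+ b ] (- (1ℤ + (1ℤ + (+ a + + a)))) (+ 2 + (+ a + + b)) (+ 3 + (+ b + + b)) -[1+ suc (suc (a ℕ.+ b)) ]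
      (e₁ (+ a)) (e₂ (+ a) (+ b)) (e₃ (+ b)) (e₄ (+ a) (+ b)) refl
    where
    e₁ : ∀ A → - (1ℤ + A) * + 2 ≡ - (1ℤ + (1ℤ + (A + A)))
    e₁ = solve-∀
    e₂ : ∀ A B → - - (1ℤ + A) - - (1ℤ + B) ≡ + 2 + (A + B)
    e₂ = solve-∀
    e₃ : ∀ B → 1ℤ - - (1ℤ + B) * + 2 ≡ + 3 + (B + B)
    e₃ = solve-∀
    e₄ : ∀ A B → - (1ℤ + A) + - (1ℤ + B) - 1ℤ ≡ - (1ℤ + (1ℤ + (1ℤ + (A + B))))
    e₄ = solve-∀
  quadrantSplit⁻ a (+ suc b) with suc a ℕP.≤? b
  ... | yes a<b with ℕP.m≤n⇒∃[o]m+o≡n a<b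
  ...   | d , refl =
    via -[1+ a ] (+ suc (suc (a ℕ.+ d))) (- (1ℤ + (1ℤ + (+ a + + a)))) -[1+ d ] (- (1ℤ + (1ℤ + (1ℤ + ((+ a + + d) + (+ a + + d)))))) (+ d)
      (e₁ (+ a)) (e₂ (+ a) (+ d)) (e₃ (+ a) (+ d)) (e₄ (+ a) (+ d)) (-x≡-x+0-0 (neg1pow ((+ suc (suc (a ℕ.+ d))) - -[1+ a ])))
    where
    e₁ : ∀ A → - (1ℤ + A) * + 2 ≡ - (1ℤ + (1ℤ + (A + A)))
    e₁ = solve-∀
    e₂ : ∀ A D → - - (1ℤ + A) - (1ℤ + (1ℤ + (A + D))) ≡ - (1ℤ + D)
    e₂ = solve-∀
    e₃ : ∀ A D → 1ℤ - (1ℤ + (1ℤ + (A + D))) * + 2 ≡ - (1ℤ + (1ℤ + (1ℤ + ((A + D) + (A + D)))))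
    e₃ = solve-∀
    e₄ : ∀ A D → - (1ℤ + A) + (1ℤ + (1ℤ + (A + D))) - 1ℤ ≡ D
    e₄ = solve-∀
  quadrantSplit⁻ a (+ suc b) | no a≮b with ℕP.m≤n⇒∃[o]m+o≡n (ℕP.≤-pred (ℕP.≰⇒> a≮b))
  ...   | d , refl =
    via -[1+ (b ℕ.+ d) ] (+ suc b) (- (1ℤ + (1ℤ + ((+ b + + d) + (+ b + + d))))) (+ d) -[1+ (b ℕ.+ b) ] -[1+ d ]
      (e₁ (+ b) (+ d)) (e₂ (+ b) (+ d)) (e₃ (+ b)) (e₄ (+ b) (+ d)) (-x≡0+-x-0 (neg1pow ((+ suc b) - -[1+ (b ℕ.+ d) ])))
    where
    e₁ : ∀ B D → - (1ℤ + (B + D)) * + 2 ≡ - (1ℤ + (1ℤ + ((B + D) + (B + D))))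
    e₁ = solve-∀
    e₂ : ∀ B D → - - (1ℤ + (B + D)) - (1ℤ + B) ≡ D
    e₂ = solve-∀
    e₃ : ∀ B → 1ℤ - (1ℤ + B) * + 2 ≡ - (1ℤ + (B + B))
    e₃ = solve-∀
    e₄ : ∀ B D → - (1ℤ + (B + D)) + (1ℤ + B) - 1ℤ ≡ - (1ℤ + D)
    e₄ = solve-∀

  quadrantSplit : ∀ j k → Splits j k
  quadrantSplit (+ zero)  = quadrantSplit⁰
  quadrantSplit (+ suc a) = quadrantSplit⁺ a
  quadrantSplit -[1+ a ]  = quadrantSplit⁻ a

  stringWeight-split : ∀ j k →
    stringWeight j k ≡ fWeight (r₁ j k) (s₁ j k) + fWeight (r₂ j k) (s₂ j k) - axisWeight j k
  stringWeight-split j k = trans (quadrantSplit j k)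
    (sym (cong₂ (λ u v → u + v - axisWeight j k) (fWeight-r₁s₁ j k) (fWeight-r₂s₂ j k)))

module CoefficientExtraction where

  open import Data.Integer using (_+_; _-_; -_; 0ℤ; _≟_)
  open import Relation.Nullary using (yes; no; ¬_)
  open import Data.Empty using (⊥-elim)
  open import Relation.Binary.PropositionalEquality

  onExp-≢ : ∀ n e w → ¬ (e ≡ n) → onExp n e w ≡ 0ℤ
  onExp-≢ n e w e≢n with e ≟ n
  ... | yes e≡n = ⊥-elim (e≢n e≡n)
  ... | no _    = refl

  onExp-0 : ∀ n e → onExp n e 0ℤ ≡ 0ℤ
  onExp-0 n e with e ≟ n
  ... | yes _ = refl
  ... | no _  = refl

  onExp-neg : ∀ n e w → onExp n e (- w) ≡ - onExp n e w
  onExp-neg n e w with e ≟ n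
  ... | yes _ = refl
  ... | no _  = refl

  onExp-+- : ∀ n e a b c → onExp n e a + onExp n e b - onExp n e c ≡ onExp n e (a + b - c)
  onExp-+- n e a b c with e ≟ n
  ... | yes _ = refl
  ... | no _  = refl

module Parity where

  open import Data.Nat as ℕ using (_%_)
  import Data.Nat.DivMod as ℕD
  open import Data.Integer using (+_; _+_; _*_; _-_)
  import Data.Integer.Properties as ℤP
  open import Data.Integer.Tactic.RingSolver using (solve-∀)
  open import Relation.Binary.PropositionalEquality

  -- Q = (K − ℓ)/2 may be negative, so it is carried as x − y with x y : ℕ.
  record Halves (K ℓ : ℕ) : Set where
    field
      p x y   : ℕ
      K+ℓ≡p*2 : + K + + ℓ ≡ + p * + 2
      K-ℓ≡Q*2 : + K - + ℓ ≡ (+ x - + y) * + 2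
      K≡p+Q   : + K ≡ + p + (+ x - + y)

  halves : ∀ K ℓ → K % 2 ≡ ℓ % 2 → Halves K ℓ
  halves K ℓ K≡ℓ = record
    { p = a ℕ.+ b ℕ.+ r ; x = a ; y = b
    ; K+ℓ≡p*2 = trans (cong₂ _+_ K≡r+a*2 ℓ≡r+b*2) (sum (+ r) (+ a) (+ b))
    ; K-ℓ≡Q*2 = trans (cong₂ _-_ K≡r+a*2 ℓ≡r+b*2) (difference (+ r) (+ a) (+ b))
    ; K≡p+Q   = trans K≡r+a*2 (regroup (+ r) (+ a) (+ b))
    }
    where
    r a b : ℕ
    r = K % 2
    a = K ℕD./ 2
    b = ℓ ℕD./ 2
    K≡r+a*2 : + K ≡ + r + + a * + 2
    K≡r+a*2 = trans (cong +_ (ℕD.m≡m%n+[m/n]*n K 2)) (cong (_+_ (+ r)) (ℤP.pos-* a 2))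
    ℓ≡r+b*2 : + ℓ ≡ + r + + b * + 2
    ℓ≡r+b*2 = trans (cong +_ (ℕD.m≡m%n+[m/n]*n ℓ 2))
      (trans (cong (λ t → + t + + (b ℕ.* 2)) (sym K≡ℓ)) (cong (_+_ (+ r)) (ℤP.pos-* b 2)))
    sum : ∀ r a b → (r + a * + 2) + (r + b * + 2) ≡ (a + b + r) * + 2
    sum = solve-∀
    difference : ∀ r a b → (r + a * + 2) - (r + b * + 2) ≡ (a - b) * + 2
    difference = solve-∀
    regroup : ∀ r a b → r + a * + 2 ≡ (a + b + r) + (a - b)
    regroup = solve-∀

module Corollary {K ℓ : ℕ} (H : Parity.Halves K ℓ) where

  open Parity.Halves H
  open Arithmetic
  open Signs
  open IntervalSum
  open BoxSum using (boxSum≡symSum²)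
  open QuadraticGrowth
  open CoefficientExtraction
  open import Data.Nat as ℕ using (zero; suc)
  import Data.Nat.Properties as ℕP
  import Data.Nat.Tactic.RingSolver as ℕRing
  open import Data.Integer as ℤ using (ℤ; +_; -[1+_]; _+_; _*_; _-_; -_; ∣_∣; 0ℤ; 1ℤ; -1ℤ)
  import Data.Integer.Properties as ℤP
  open import Data.Integer.Tactic.RingSolver using (solve-∀)
  open import Data.Product using (∃-syntax; _,_; proj₁; proj₂)
  open import Data.Sum as Sum using (_⊎_; inj₁; inj₂)
  open import Data.Empty using (⊥)
  open import Function using (_∘_)
  open import Relation.Binary.PropositionalEquality
  open ≡-Reasoning

  P Q : ℤ
  P = + p
  Q = + x - + y

  fE : ℤ → ℤ → ℤ
  fE = fExp (+ K + + 1) (+ K + + 1) (+ 1) (+ 1 + half (+ K + + ℓ)) (+ 1 - half (+ K - + ℓ))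

  sE : ℤ → ℤ → ℤ
  sE = stringExp (+ (2 ℕ.* K)) (+ K) (+ ℓ)

  fE-polynomial sE-polynomial : ℤ → ℤ → ℤ
  fE-polynomial r s = (1ℤ + P) * r + (1ℤ - Q) * s + (P + Q + 1ℤ) * binom2 r + (P + Q + 1ℤ) * r * s + + 1 * binom2 s
  sE-polynomial j k = binom2 (k - j) - + 2 * (P + Q) * j * k + k * Q + j * P

  fE-expand : ∀ r s → fE r s ≡ fE-polynomial r s
  fE-expand r s = trans
    (cong₂ (λ u v → fExp (+ K + + 1) (+ K + + 1) (+ 1) (+ 1 + u) (+ 1 - v) r s)
      (trans (cong half K+ℓ≡p*2) (half-*2 P)) (trans (cong half K-ℓ≡Q*2) (half-*2 Q)))
    (cong (λ t → fExp (t + + 1) (t + + 1) (+ 1) (+ 1 + P) (+ 1 - Q) r s) K≡p+Q)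

  sE-expand : ∀ j k → sE j k ≡ sE-polynomial j k
  sE-expand j k = trans
    (cong₂ (λ u v → binom2 (k - j) - u * j * k + half (k * v) + half (j * (+ K + + ℓ)))
      (trans (ℤP.pos-* 2 K) (cong (_*_ (+ 2)) K≡p+Q)) K-ℓ≡Q*2)
    (cong₂ (λ u v → binom2 (k - j) - + 2 * (P + Q) * j * k + u + v)
      (trans (cong half (*-assoc₂ k Q)) (half-*2 (k * Q)))
      (trans (cong half (trans (cong (_*_ j) K+ℓ≡p*2) (*-assoc₂ j P))) (half-*2 (j * P))))
    where
    *-assoc₂ : ∀ a b → a * (b * + 2) ≡ a * b * + 2
    *-assoc₂ = solve-∀

  fE-r₁s₁≡sE : ∀ j k → fE (r₁ j k) (s₁ j k) ≡ sE j k
  fE-r₁s₁≡sE j k = trans (fE-expand (j * + 2) (- j - k)) (trans (i*2-j*2≡0⇒i≡j _ _ defects) (sym (sE-expand j k)))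
    where
    expand : ∀ j k P Q b₁ b₂ b₃ →
      ((1ℤ + P) * (j * + 2) + (1ℤ - Q) * (- j - k) + (P + Q + 1ℤ) * b₁ + (P + Q + 1ℤ) * (j * + 2) * (- j - k) + + 1 * b₂) * + 2
        - (b₃ - + 2 * (P + Q) * j * k + k * Q + j * P) * + 2
      ≡ (P + Q + 1ℤ) * (b₁ * + 2 - (j * + 2) * ((j * + 2) - 1ℤ)) + (b₂ * + 2 - (- j - k) * ((- j - k) - 1ℤ))
        - (b₃ * + 2 - (k - j) * ((k - j) - 1ℤ))
    expand = solve-∀
    collapse : ∀ A → A * 0ℤ + 0ℤ - 0ℤ ≡ 0ℤ
    collapse = solve-∀
    defects : fE-polynomial (j * + 2) (- j - k) * + 2 - sE-polynomial j k * + 2 ≡ 0ℤ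
    defects = trans (expand j k P Q (binom2 (j * + 2)) (binom2 (- j - k)) (binom2 (k - j)))
      (trans (cong₂ (λ u v → (P + Q + 1ℤ) * u + v - (binom2 (k - j) * + 2 - (k - j) * ((k - j) - 1ℤ)))
                (binom2*2-r*[r-1]≡0 (j * + 2)) (binom2*2-r*[r-1]≡0 (- j - k)))
      (trans (cong (λ w → (P + Q + 1ℤ) * 0ℤ + 0ℤ - w) (binom2*2-r*[r-1]≡0 (k - j))) (collapse (P + Q + 1ℤ))))

  fE-r₂s₂≡sE : ∀ j k → fE (r₂ j k) (s₂ j k) ≡ sE j k
  fE-r₂s₂≡sE j k = trans (fE-expand (1ℤ - k * + 2) (j + k - 1ℤ)) (trans (i*2-j*2≡0⇒i≡j _ _ defects) (sym (sE-expand j k)))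
    where
    expand : ∀ j k P Q b₁ b₂ b₃ →
      ((1ℤ + P) * (1ℤ - k * + 2) + (1ℤ - Q) * (j + k - 1ℤ) + (P + Q + 1ℤ) * b₁ + (P + Q + 1ℤ) * (1ℤ - k * + 2) * (j + k - 1ℤ) + + 1 * b₂) * + 2
        - (b₃ - + 2 * (P + Q) * j * k + k * Q + j * P) * + 2
      ≡ (P + Q + 1ℤ) * (b₁ * + 2 - (1ℤ - k * + 2) * ((1ℤ - k * + 2) - 1ℤ)) + (b₂ * + 2 - (j + k - 1ℤ) * ((j + k - 1ℤ) - 1ℤ))
        - (b₃ * + 2 - (k - j) * ((k - j) - 1ℤ))
    expand = solve-∀
    collapse : ∀ A → A * 0ℤ + 0ℤ - 0ℤ ≡ 0ℤ
    collapse = solve-∀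
    defects : fE-polynomial (1ℤ - k * + 2) (j + k - 1ℤ) * + 2 - sE-polynomial j k * + 2 ≡ 0ℤ
    defects = trans (expand j k P Q (binom2 (1ℤ - k * + 2)) (binom2 (j + k - 1ℤ)) (binom2 (k - j)))
      (trans (cong₂ (λ u v → (P + Q + 1ℤ) * u + v - (binom2 (k - j) * + 2 - (k - j) * ((k - j) - 1ℤ)))
                (binom2*2-r*[r-1]≡0 (1ℤ - k * + 2)) (binom2*2-r*[r-1]≡0 (j + k - 1ℤ)))
      (trans (cong (λ w → (P + Q + 1ℤ) * 0ℤ + 0ℤ - w) (binom2*2-r*[r-1]≡0 (k - j))) (collapse (P + Q + 1ℤ))))

  K-[P+Q]≡0 : + K - (P + Q) ≡ 0ℤ
  K-[P+Q]≡0 = ℤP.i≡j⇒i-j≡0 K≡p+Q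

  mirror : ℤ
  mirror = 1ℤ - Q * + 2

  sE-axis-mirror : ∀ k → sE (+ 0) (mirror - k) ≡ sE (+ 0) k
  sE-axis-mirror k = trans (sE-expand (+ 0) (mirror - k)) (trans (i*2-j*2≡0⇒i≡j _ _ defects) (sym (sE-expand (+ 0) k)))
    where
    expand : ∀ k P Q b₁ b₂ →
      (b₁ - + 2 * (P + Q) * + 0 * (1ℤ - Q * + 2 - k) + (1ℤ - Q * + 2 - k) * Q + + 0 * P) * + 2
        - (b₂ - + 2 * (P + Q) * + 0 * k + k * Q + + 0 * P) * + 2
      ≡ (b₁ * + 2 - (1ℤ - Q * + 2 - k - + 0) * ((1ℤ - Q * + 2 - k - + 0) - 1ℤ)) - (b₂ * + 2 - (k - + 0) * ((k - + 0) - 1ℤ))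
    expand = solve-∀
    defects : sE-polynomial (+ 0) (mirror - k) * + 2 - sE-polynomial (+ 0) k * + 2 ≡ 0ℤ
    defects = trans (expand k P Q (binom2 (mirror - k - + 0)) (binom2 (k - + 0)))
      (cong₂ _-_ (binom2*2-r*[r-1]≡0 (mirror - k - + 0)) (binom2*2-r*[r-1]≡0 (k - + 0)))

  module Coefficient (n : ℤ) where

    ∣n∣ : ℤ
    ∣n∣ = + ∣ n ∣

    N₀ L₀ : ℤ
    N₀ = ∣n∣ * + 2 + + 4 + + 2 * + p + + 2 * + x + + 2 * + y
    L₀ = + 2 + + 2 * + p + + 2 * + x + + 2 * + y

    isNat-N₀ : IsNat N₀
    isNat-N₀ = isNat-+ (isNat-+ (isNat-+ (isNat-+ (isNat-* (isNat ∣ n ∣) (isNat 2)) (isNat 4))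
      (isNat-* (isNat 2) (isNat p))) (isNat-* (isNat 2) (isNat x))) (isNat-* (isNat 2) (isNat y))

    isNat-L₀ : IsNat L₀
    isNat-L₀ = isNat-+ (isNat-+ (isNat-+ (isNat 2) (isNat-* (isNat 2) (isNat p)))
      (isNat-* (isNat 2) (isNat x))) (isNat-* (isNat 2) (isNat y))

    N L : ℕ
    N = proj₁ isNat-N₀
    L = proj₁ isNat-L₀

    Bounded : ℕ → ℕ → Set
    Bounded a b = a ℕ.* a ℕ.+ b ℕ.* b ℕ.≤ N ℕ.+ L ℕ.* (a ℕ.+ b)

    bounded-fromℤ : ∀ a b → + a * + a + + b * + b ℤ.≤ N₀ + L₀ * (+ a + + b) → Bounded a b
    bounded-fromℤ a b h = ℤP.drop‿+≤+ (subst₂ ℤ._≤_ lhs rhs h)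
      where
      lhs : + a * + a + + b * + b ≡ + (a ℕ.* a ℕ.+ b ℕ.* b)
      lhs = sym (trans (ℤP.pos-+ (a ℕ.* a) (b ℕ.* b)) (cong₂ _+_ (ℤP.pos-* a a) (ℤP.pos-* b b)))
      rhs : N₀ + L₀ * (+ a + + b) ≡ + (N ℕ.+ L ℕ.* (a ℕ.+ b))
      rhs = trans (cong₂ (λ u v → u + v * (+ a + + b)) (proj₂ isNat-N₀) (proj₂ isNat-L₀))
        (sym (trans (ℤP.pos-+ N (L ℕ.* (a ℕ.+ b))) (cong (_+_ (+ N)) (ℤP.pos-* L (a ℕ.+ b)))))

    -- Each bound below exhibits N₀ + L₀ (a + b) - (a² + b²) as 2 (∣n∣ - n) + R with R visibly a
    -- natural number; in the ring-solver identity the defining equations of fE, binom2 and K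
    -- appear as extra terms that are then shown to vanish.
    drop-zeros₄ : ∀ u R w → u * + 2 + R + 0ℤ * + 2 + 0ℤ + 0ℤ - 0ℤ * w * + 2 ≡ u * + 2 + R
    drop-zeros₄ = solve-∀

    drop-zeros₂ : ∀ u R → u * + 2 + R + 0ℤ * + 2 + 0ℤ ≡ u * + 2 + R
    drop-zeros₂ = solve-∀

    fE⁺⁺-bounded : ∀ a b → fE (+ a) (+ b) ≡ n → Bounded a b
    fE⁺⁺-bounded a b h = bounded-fromℤ a b (isNat[j-i]⇒i≤j (subst IsNat (sym certificate) isNat-R))
      where
      A B TA TB F R : ℤ
      A = + a
      B = + b
      TA = binom2 A
      TB = binom2 B
      F = fE A B
      R = + 4 + + 2 * P + + 2 * + x + + 2 * + y + A * (+ 3 + + 4 * P + + 2 * + x + + 2 * + y)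
          + B * (+ 3 + + 2 * P + + 4 * + y) + + 2 * + K * TA + + 2 * (+ K + + 1) * A * B
      isNat-R : IsNat ((∣n∣ - n) * + 2 + R)
      isNat-R = isNat-+ (isNat-* (isNat-∣i∣-i n) (isNat 2))
        (isNat-+ (isNat-+ (isNat-+ (isNat-+ (isNat-+ (isNat-+ (isNat-+
          (isNat 4)
          (isNat-* (isNat 2) (isNat p)))
          (isNat-* (isNat 2) (isNat x)))
          (isNat-* (isNat 2) (isNat y)))
          (isNat-* (isNat a) (isNat-+ (isNat-+ (isNat-+ (isNat 3) (isNat-* (isNat 4) (isNat p))) (isNat-* (isNat 2) (isNat x)))
            (isNat-* (isNat 2) (isNat y)))))
          (isNat-* (isNat b) (isNat-+ (isNat-+ (isNat 3) (isNat-* (isNat 2) (isNat p))) (isNat-* (isNat 4) (isNat y)))))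
          (isNat-* (isNat-* (isNat 2) (isNat K)) (isNat-binom2 A)))
          (isNat-* (isNat-* (isNat-* (isNat 2) (isNat-+ (isNat K) (isNat 1))) (isNat a)) (isNat b)))
      expand : ∀ A B p x y K ∣n∣ F TA TB →
        (∣n∣ * + 2 + + 4 + + 2 * p + + 2 * x + + 2 * y + (+ 2 + + 2 * p + + 2 * x + + 2 * y) * (A + B)) - (A * A + B * B)
        ≡ (∣n∣ - F) * + 2 + (+ 4 + + 2 * p + + 2 * x + + 2 * y + A * (+ 3 + + 4 * p + + 2 * x + + 2 * y)
            + B * (+ 3 + + 2 * p + + 4 * y) + + 2 * K * TA + + 2 * (K + + 1) * A * B)
          + (F - ((1ℤ + p) * A + (1ℤ - (x - y)) * B + (p + (x - y) + 1ℤ) * TA + (p + (x - y) + 1ℤ) * A * B + + 1 * TB)) * + 2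
          + (TA * + 2 - A * (A - 1ℤ)) + (TB * + 2 - B * (B - 1ℤ)) - (K - (p + (x - y))) * (TA + A * B) * + 2
      expand = solve-∀
      certificate : N₀ + L₀ * (A + B) - (A * A + B * B) ≡ (∣n∣ - n) * + 2 + R
      certificate = begin
        N₀ + L₀ * (A + B) - (A * A + B * B)
          ≡⟨ expand A B P (+ x) (+ y) (+ K) ∣n∣ F TA TB ⟩
        (∣n∣ - F) * + 2 + R + (F - _) * + 2 + (TA * + 2 - A * (A - 1ℤ)) + (TB * + 2 - B * (B - 1ℤ)) - (+ K - (P + Q)) * (TA + A * B) * + 2
          ≡⟨ cong₂ (λ d₀ d₁ → (∣n∣ - F) * + 2 + R + d₀ * + 2 + d₁ + (TB * + 2 - B * (B - 1ℤ)) - (+ K - (P + Q)) * (TA + A * B) * + 2)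
               (ℤP.i≡j⇒i-j≡0 (fE-expand A B)) (binom2*2-r*[r-1]≡0 A) ⟩
        (∣n∣ - F) * + 2 + R + 0ℤ * + 2 + 0ℤ + (TB * + 2 - B * (B - 1ℤ)) - (+ K - (P + Q)) * (TA + A * B) * + 2
          ≡⟨ cong₂ (λ d₂ d₃ → (∣n∣ - F) * + 2 + R + 0ℤ * + 2 + 0ℤ + d₂ - d₃ * (TA + A * B) * + 2)
               (binom2*2-r*[r-1]≡0 B) K-[P+Q]≡0 ⟩
        (∣n∣ - F) * + 2 + R + 0ℤ * + 2 + 0ℤ + 0ℤ - 0ℤ * (TA + A * B) * + 2
          ≡⟨ drop-zeros₄ (∣n∣ - F) R (TA + A * B) ⟩
        (∣n∣ - F) * + 2 + R
          ≡⟨ cong (λ t → (∣n∣ - t) * + 2 + R) h ⟩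
        (∣n∣ - n) * + 2 + R ∎

    fE⁻⁻-bounded : ∀ a b → fE -[1+ a ] -[1+ b ] ≡ n → Bounded a b
    fE⁻⁻-bounded a b h = bounded-fromℤ a b (isNat[j-i]⇒i≤j (subst IsNat (sym certificate) isNat-R))
      where
      A B rA rB TA TB F R : ℤ
      A = + a
      B = + b
      rA = -[1+ a ]
      rB = -[1+ b ]
      TA = binom2 rA
      TB = binom2 rB
      F = fE rA rB
      R = + 4 + + 4 * + x + A * (+ 3 + + 2 * + x + + 2 * + y) + B * (+ 3 + + 2 * P + + 4 * + x)
          + + 2 * + K * TA + + 2 * (+ K + + 1) * (1ℤ + A) * (1ℤ + B)
      isNat-R : IsNat ((∣n∣ - n) * + 2 + R)
      isNat-R = isNat-+ (isNat-* (isNat-∣i∣-i n) (isNat 2))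
        (isNat-+ (isNat-+ (isNat-+ (isNat-+
          (isNat-+ (isNat 4) (isNat-* (isNat 4) (isNat x)))
          (isNat-* (isNat a) (isNat-+ (isNat-+ (isNat 3) (isNat-* (isNat 2) (isNat x))) (isNat-* (isNat 2) (isNat y)))))
          (isNat-* (isNat b) (isNat-+ (isNat-+ (isNat 3) (isNat-* (isNat 2) (isNat p))) (isNat-* (isNat 4) (isNat x)))))
          (isNat-* (isNat-* (isNat 2) (isNat K)) (isNat-binom2 rA)))
          (isNat-* (isNat-* (isNat-* (isNat 2) (isNat-+ (isNat K) (isNat 1))) (isNat-+ (isNat 1) (isNat a))) (isNat-+ (isNat 1) (isNat b))))
      expand : ∀ A B p x y K ∣n∣ F TA TB →
        (∣n∣ * + 2 + + 4 + + 2 * p + + 2 * x + + 2 * y + (+ 2 + + 2 * p + + 2 * x + + 2 * y) * (A + B)) - (A * A + B * B)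
        ≡ (∣n∣ - F) * + 2 + (+ 4 + + 4 * x + A * (+ 3 + + 2 * x + + 2 * y) + B * (+ 3 + + 2 * p + + 4 * x)
            + + 2 * K * TA + + 2 * (K + + 1) * (1ℤ + A) * (1ℤ + B))
          + (F - ((1ℤ + p) * (- (1ℤ + A)) + (1ℤ - (x - y)) * (- (1ℤ + B)) + (p + (x - y) + 1ℤ) * TA
                  + (p + (x - y) + 1ℤ) * (- (1ℤ + A)) * (- (1ℤ + B)) + + 1 * TB)) * + 2
          + (TA * + 2 - (- (1ℤ + A)) * ((- (1ℤ + A)) - 1ℤ)) + (TB * + 2 - (- (1ℤ + B)) * ((- (1ℤ + B)) - 1ℤ))
          - (K - (p + (x - y))) * (TA + (- (1ℤ + A)) * (- (1ℤ + B))) * + 2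
      expand = solve-∀
      certificate : N₀ + L₀ * (A + B) - (A * A + B * B) ≡ (∣n∣ - n) * + 2 + R
      certificate = begin
        N₀ + L₀ * (A + B) - (A * A + B * B)
          ≡⟨ expand A B P (+ x) (+ y) (+ K) ∣n∣ F TA TB ⟩
        (∣n∣ - F) * + 2 + R + (F - _) * + 2 + (TA * + 2 - rA * (rA - 1ℤ)) + (TB * + 2 - rB * (rB - 1ℤ)) - (+ K - (P + Q)) * (TA + rA * rB) * + 2
          ≡⟨ cong₂ (λ d₀ d₁ → (∣n∣ - F) * + 2 + R + d₀ * + 2 + d₁ + (TB * + 2 - rB * (rB - 1ℤ)) - (+ K - (P + Q)) * (TA + rA * rB) * + 2)
               (ℤP.i≡j⇒i-j≡0 (fE-expand rA rB)) (binom2*2-r*[r-1]≡0 rA) ⟩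
        (∣n∣ - F) * + 2 + R + 0ℤ * + 2 + 0ℤ + (TB * + 2 - rB * (rB - 1ℤ)) - (+ K - (P + Q)) * (TA + rA * rB) * + 2
          ≡⟨ cong₂ (λ d₂ d₃ → (∣n∣ - F) * + 2 + R + 0ℤ * + 2 + 0ℤ + d₂ - d₃ * (TA + rA * rB) * + 2)
               (binom2*2-r*[r-1]≡0 rB) K-[P+Q]≡0 ⟩
        (∣n∣ - F) * + 2 + R + 0ℤ * + 2 + 0ℤ + 0ℤ - 0ℤ * (TA + rA * rB) * + 2
          ≡⟨ drop-zeros₄ (∣n∣ - F) R (TA + rA * rB) ⟩
        (∣n∣ - F) * + 2 + R
          ≡⟨ cong (λ t → (∣n∣ - t) * + 2 + R) h ⟩
        (∣n∣ - n) * + 2 + R ∎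

    sE-axis⁺-bounded : ∀ c → sE (+ 0) (+ c) ≡ n → Bounded c 0
    sE-axis⁺-bounded c h = bounded-fromℤ c 0 (isNat[j-i]⇒i≤j (subst IsNat (sym certificate) isNat-R))
      where
      C TA F R : ℤ
      C = + c
      TA = binom2 (C - + 0)
      F = sE (+ 0) C
      R = + 4 + + 2 * P + + 2 * + x + + 2 * + y + C * (+ 1 + + 2 * P + + 4 * + x)
      isNat-R : IsNat ((∣n∣ - n) * + 2 + R)
      isNat-R = isNat-+ (isNat-* (isNat-∣i∣-i n) (isNat 2))
        (isNat-+ (isNat-+ (isNat-+ (isNat-+
          (isNat 4)
          (isNat-* (isNat 2) (isNat p)))
          (isNat-* (isNat 2) (isNat x)))
          (isNat-* (isNat 2) (isNat y)))
          (isNat-* (isNat c) (isNat-+ (isNat-+ (isNat 1) (isNat-* (isNat 2) (isNat p))) (isNat-* (isNat 4) (isNat x)))))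
      expand : ∀ C p x y ∣n∣ F TA →
        (∣n∣ * + 2 + + 4 + + 2 * p + + 2 * x + + 2 * y + (+ 2 + + 2 * p + + 2 * x + + 2 * y) * (C + + 0)) - (C * C + + 0 * + 0)
        ≡ (∣n∣ - F) * + 2 + (+ 4 + + 2 * p + + 2 * x + + 2 * y + C * (+ 1 + + 2 * p + + 4 * x))
          + (F - (TA - + 2 * (p + (x - y)) * + 0 * C + C * (x - y) + + 0 * p)) * + 2
          + (TA * + 2 - (C - + 0) * ((C - + 0) - 1ℤ))
      expand = solve-∀
      certificate : N₀ + L₀ * (C + + 0) - (C * C + + 0 * + 0) ≡ (∣n∣ - n) * + 2 + R
      certificate = trans (expand C P (+ x) (+ y) ∣n∣ F TA)
        (trans (cong₂ (λ d₀ d₁ → (∣n∣ - F) * + 2 + R + d₀ * + 2 + d₁)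
                  (ℤP.i≡j⇒i-j≡0 (sE-expand (+ 0) C)) (binom2*2-r*[r-1]≡0 (C - + 0)))
        (trans (drop-zeros₂ (∣n∣ - F) R) (cong (λ t → (∣n∣ - t) * + 2 + R) h)))

    sE-axis⁻-bounded : ∀ c → sE (+ 0) -[1+ c ] ≡ n → Bounded c 0
    sE-axis⁻-bounded c h = bounded-fromℤ c 0 (isNat[j-i]⇒i≤j (subst IsNat (sym certificate) isNat-R))
      where
      C k TA F R : ℤ
      C = + c
      k = -[1+ c ]
      TA = binom2 (k - + 0)
      F = sE (+ 0) k
      R = + 6 + + 2 * P + + 4 * + y + C * (+ 5 + + 2 * P + + 4 * + y)
      isNat-R : IsNat ((∣n∣ - n) * + 2 + R)
      isNat-R = isNat-+ (isNat-* (isNat-∣i∣-i n) (isNat 2))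
        (isNat-+ (isNat-+ (isNat-+
          (isNat 6)
          (isNat-* (isNat 2) (isNat p)))
          (isNat-* (isNat 4) (isNat y)))
          (isNat-* (isNat c) (isNat-+ (isNat-+ (isNat 5) (isNat-* (isNat 2) (isNat p))) (isNat-* (isNat 4) (isNat y)))))
      expand : ∀ C p x y ∣n∣ F TA →
        (∣n∣ * + 2 + + 4 + + 2 * p + + 2 * x + + 2 * y + (+ 2 + + 2 * p + + 2 * x + + 2 * y) * (C + + 0)) - (C * C + + 0 * + 0)
        ≡ (∣n∣ - F) * + 2 + (+ 6 + + 2 * p + + 4 * y + C * (+ 5 + + 2 * p + + 4 * y))
          + (F - (TA - + 2 * (p + (x - y)) * + 0 * (- (1ℤ + C)) + (- (1ℤ + C)) * (x - y) + + 0 * p)) * + 2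
          + (TA * + 2 - ((- (1ℤ + C)) - + 0) * (((- (1ℤ + C)) - + 0) - 1ℤ))
      expand = solve-∀
      certificate : N₀ + L₀ * (C + + 0) - (C * C + + 0 * + 0) ≡ (∣n∣ - n) * + 2 + R
      certificate = trans (expand C P (+ x) (+ y) ∣n∣ F TA)
        (trans (cong₂ (λ d₀ d₁ → (∣n∣ - F) * + 2 + R + d₀ * + 2 + d₁)
                  (ℤP.i≡j⇒i-j≡0 (sE-expand (+ 0) k)) (binom2*2-r*[r-1]≡0 (k - + 0)))
        (trans (drop-zeros₂ (∣n∣ - F) R) (cong (λ t → (∣n∣ - t) * + 2 + R) h)))

    opaque
      radius : ℕ
      radius = suc (N ℕ.+ L ℕ.* L ℕ.+ L)

      bounded⇒¬outside : ∀ {a b} → Bounded a b → radius ℕ.≤ a ⊎ radius ℕ.≤ b → ⊥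
      bounded⇒¬outside {a} {b} h (inj₁ radius≤a) = ℕP.<⇒≱ radius≤a (a*a+b*b≤N+L*[a+b]⇒a≤N+L*L+L N L a b h)
      bounded⇒¬outside {a} {b} h (inj₂ radius≤b) = ℕP.<⇒≱ radius≤b (a*a+b*b≤N+L*[a+b]⇒b≤N+L*L+L N L a b h)

    fTerm : ℤ → ℤ → ℤ
    fTerm r s = onExp n (fE r s) (fWeight r s)

    fTerm-supported : ∀ r s → Outside radius r ⊎ Outside radius s → fTerm r s ≡ 0ℤ
    fTerm-supported (+ a)    (+ b)    o = onExp-≢ n _ _ λ e → bounded⇒¬outside (fE⁺⁺-bounded a b e)
      (Sum.map (ℕP.<⇒≤ ∘ outside⁺⇒< radius a) (ℕP.<⇒≤ ∘ outside⁺⇒< radius b) o)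
    fTerm-supported (+ a)    -[1+ b ] o = onExp-0 n (fE (+ a) -[1+ b ])
    fTerm-supported -[1+ a ] (+ b)    o = onExp-0 n (fE -[1+ a ] (+ b))
    fTerm-supported -[1+ a ] -[1+ b ] o = onExp-≢ n _ _ λ e → bounded⇒¬outside (fE⁻⁻-bounded a b e)
      (Sum.map (outside⁻⇒≤ radius a) (outside⁻⇒≤ radius b) o)

    axisTerm : ℤ → ℤ
    axisTerm k = onExp n (sE (+ 0) k) (neg1pow (k - + 0))

    axisTerm-supported : SupportedIn radius axisTerm
    axisTerm-supported (+ c)    o = onExp-≢ n _ _ λ e →
      bounded⇒¬outside (sE-axis⁺-bounded c e) (inj₁ (ℕP.<⇒≤ (outside⁺⇒< radius c o)))
    axisTerm-supported -[1+ c ] o = onExp-≢ n _ _ λ e →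
      bounded⇒¬outside (sE-axis⁻-bounded c e) (inj₁ (outside⁻⇒≤ radius c o))

    fRow : ℤ → ℤ
    fRow r = symSum radius (fTerm r)

    fTerm-row-supported : ∀ r → SupportedIn radius (fTerm r)
    fTerm-row-supported r s o = fTerm-supported r s (inj₂ o)

    fRow-supported : SupportedIn radius fRow
    fRow-supported r o = sumFrom-zero (- + radius) (suc (radius ℕ.+ radius)) (fTerm r) (λ s → fTerm-supported r s (inj₁ o))

    axisTerm-mirror : ∀ k → axisTerm (mirror - k) ≡ - axisTerm k
    axisTerm-mirror k = trans (cong₂ (onExp n) (sE-axis-mirror k) sign) (onExp-neg n (sE (+ 0) k) (neg1pow (k - + 0)))
      where
      reflect : ∀ k Q → 1ℤ - Q * + 2 - k - + 0 ≡ - ((k - + 0) + Q * + 2) + 1ℤ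
      reflect = solve-∀
      sign : neg1pow (mirror - k - + 0) ≡ - neg1pow (k - + 0)
      sign = trans (cong neg1pow (reflect k Q)) (trans (neg1pow-suc (- ((k - + 0) + Q * + 2)))
        (cong -_ (trans (neg1pow-neg ((k - + 0) + Q * + 2)) (neg1pow-+*2 (k - + 0) Q))))

    -- Room for the shift by mirror = 1 − 2Q, whose size is at most 2x + 2y + 1.
    margin : ℕ
    margin = 2 ℕ.+ (x ℕ.+ x ℕ.+ (y ℕ.+ y))

    threshold : ℕ
    threshold = radius ℕ.+ radius ℕ.+ margin

    module Window (w : ℕ) where

      B : ℕ
      B = threshold ℕ.+ w

      width : ℕ
      width = suc (B ℕ.+ B)

      symSum-widen : ∀ (g : ℤ → ℤ) → SupportedIn radius g → symSum B g ≡ symSum radius g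
      symSum-widen g supp = sumFrom-window radius g supp _ _ d d (start (+ radius) (+ margin) (+ w)) (length radius margin w)
        where
        d : ℕ
        d = radius ℕ.+ margin ℕ.+ w
        length : ∀ M C w → suc (M ℕ.+ M ℕ.+ C ℕ.+ w ℕ.+ (M ℕ.+ M ℕ.+ C ℕ.+ w)) ≡ (M ℕ.+ C ℕ.+ w) ℕ.+ (suc (M ℕ.+ M) ℕ.+ (M ℕ.+ C ℕ.+ w))
        length = ℕRing.solve-∀
        start : ∀ M C w → - (M + M + C + w) ≡ - M - (M + C + w)
        start = solve-∀

      fTerm-r₁s₁-rows : ∀ j → symSum B (λ k → fTerm (r₁ j k) (s₁ j k)) ≡ fRow (j * + 2)
      fTerm-r₁s₁-rows j with inside⊎outside radius j
      ... | inj₂ o = trans (sumFrom-zero (- + B) width _ (λ k → fTerm-supported (j * + 2) _ (inj₁ (outside-*2 radius j o))))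
                           (sym (fRow-supported _ (outside-*2 radius j o)))
      ... | inj₁ (v , v′ , v+v′≡2M , refl) = begin
        sumFrom (- + B) width (λ k → fTerm (j * + 2) (- j - k))  ≡⟨ sumFrom-cong (- + B) width (λ k → cong (fTerm (j * + 2)) (swap j k)) ⟩
        sumFrom (- + B) width (λ k → g (- k))                    ≡⟨ sumFrom-reflect (- + B) width g ⟩
        sumFrom (- (- + B + + width) + 1ℤ) width g               ≡⟨ cong (λ t → sumFrom t width g) (recentre (+ B)) ⟩
        sumFrom (- + B) width (λ u → fTerm (j * + 2) (u + - j))  ≡⟨ sumFrom-shift (- + B) width (- j) (fTerm (j * + 2)) ⟩
        sumFrom (- + B + - j) width (fTerm (j * + 2))
          ≡⟨ sumFrom-window radius (fTerm (j * + 2)) (fTerm-row-supported _) _ _ (margin ℕ.+ w ℕ.+ v) (v′ ℕ.+ (margin ℕ.+ w))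
               (start (+ radius) (+ margin) (+ w) (+ v)) (length radius margin w v v′ v+v′≡2M) ⟩
        fRow (j * + 2) ∎
        where
        g : ℤ → ℤ
        g u = fTerm (j * + 2) (u + - j)
        swap : ∀ j k → - j - k ≡ - k + - j
        swap = solve-∀
        recentre : ∀ W → - (- W + (1ℤ + (W + W))) + 1ℤ ≡ - W
        recentre = solve-∀
        start : ∀ M C w v → - (M + M + C + w) + - (v - M) ≡ - M - (C + w + v)
        start = solve-∀
        length : ∀ M C w v v′ → v ℕ.+ v′ ≡ M ℕ.+ M →
          suc (M ℕ.+ M ℕ.+ C ℕ.+ w ℕ.+ (M ℕ.+ M ℕ.+ C ℕ.+ w)) ≡ C ℕ.+ w ℕ.+ v ℕ.+ (suc (M ℕ.+ M) ℕ.+ (v′ ℕ.+ (C ℕ.+ w)))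
        length M C w v v′ e = trans (regroup M C w) (trans (cong (λ t → suc (M ℕ.+ M ℕ.+ t ℕ.+ C ℕ.+ w ℕ.+ C ℕ.+ w)) (sym e)) (split M C w v v′))
          where
          regroup : ∀ M C w → suc (M ℕ.+ M ℕ.+ C ℕ.+ w ℕ.+ (M ℕ.+ M ℕ.+ C ℕ.+ w)) ≡ suc (M ℕ.+ M ℕ.+ (M ℕ.+ M) ℕ.+ C ℕ.+ w ℕ.+ C ℕ.+ w)
          regroup = ℕRing.solve-∀
          split : ∀ M C w v v′ → suc (M ℕ.+ M ℕ.+ (v ℕ.+ v′) ℕ.+ C ℕ.+ w ℕ.+ C ℕ.+ w) ≡ C ℕ.+ w ℕ.+ v ℕ.+ (suc (M ℕ.+ M) ℕ.+ (v′ ℕ.+ (C ℕ.+ w)))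
          split = ℕRing.solve-∀

      fTerm-r₂s₂-columns : ∀ k → symSum B (λ j → fTerm (r₂ j k) (s₂ j k)) ≡ fRow (1ℤ - k * + 2)
      fTerm-r₂s₂-columns k with inside⊎outside radius k
      ... | inj₂ o = trans (sumFrom-zero (- + B) width _ (λ j → fTerm-supported (1ℤ - k * + 2) _ (inj₁ (outside-1-*2 radius k o))))
                           (sym (fRow-supported _ (outside-1-*2 radius k o)))
      ... | inj₁ (v , v′ , v+v′≡2M , refl) = begin
        sumFrom (- + B) width (λ j → fTerm (1ℤ - k * + 2) (j + k - 1ℤ))   ≡⟨ sumFrom-cong (- + B) width (λ j → cong (fTerm (1ℤ - k * + 2)) (ℤP.+-assoc j k -1ℤ)) ⟩
        sumFrom (- + B) width (λ j → fTerm (1ℤ - k * + 2) (j + (k - 1ℤ))) ≡⟨ sumFrom-shift (- + B) width (k - 1ℤ) (fTerm (1ℤ - k * + 2)) ⟩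
        sumFrom (- + B + (k - 1ℤ)) width (fTerm (1ℤ - k * + 2))
          ≡⟨ sumFrom-window radius (fTerm (1ℤ - k * + 2)) (fTerm-row-supported _) _ _ (v′ ℕ.+ margin ℕ.+ w ℕ.+ 1) (v ℕ.+ C′ ℕ.+ w)
               start (length radius C′ w v v′ v+v′≡2M) ⟩
        fRow (1ℤ - k * + 2) ∎
        where
        C′ : ℕ
        C′ = 1 ℕ.+ (x ℕ.+ x ℕ.+ (y ℕ.+ y))
        difference : ∀ M C′ w v v′ → (- (M + M + (1ℤ + C′) + w) + ((v - M) - 1ℤ)) - (- M - (v′ + (1ℤ + C′) + w + 1ℤ)) ≡ (v + v′) - (M + M)
        difference = solve-∀
        start : - + B + (k - 1ℤ) ≡ - + radius - + (v′ ℕ.+ margin ℕ.+ w ℕ.+ 1)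
        start = ℤP.i-j≡0⇒i≡j _ _ (trans (difference (+ radius) (+ C′) (+ w) (+ v) (+ v′))
          (trans (cong (λ t → + t - + (radius ℕ.+ radius)) v+v′≡2M) (ℤP.+-inverseʳ (+ (radius ℕ.+ radius)))))
        length : ∀ M C′ w v v′ → v ℕ.+ v′ ≡ M ℕ.+ M →
          suc (M ℕ.+ M ℕ.+ (1 ℕ.+ C′) ℕ.+ w ℕ.+ (M ℕ.+ M ℕ.+ (1 ℕ.+ C′) ℕ.+ w))
            ≡ v′ ℕ.+ (1 ℕ.+ C′) ℕ.+ w ℕ.+ 1 ℕ.+ (suc (M ℕ.+ M) ℕ.+ (v ℕ.+ C′ ℕ.+ w))
        length M C′ w v v′ e = trans (regroup M C′ w)
          (trans (cong (λ t → suc (suc (suc (M ℕ.+ M ℕ.+ t ℕ.+ C′ ℕ.+ w ℕ.+ C′ ℕ.+ w)))) (sym e)) (split M C′ w v v′))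
          where
          regroup : ∀ M C′ w → suc (M ℕ.+ M ℕ.+ (1 ℕ.+ C′) ℕ.+ w ℕ.+ (M ℕ.+ M ℕ.+ (1 ℕ.+ C′) ℕ.+ w))
                             ≡ suc (suc (suc (M ℕ.+ M ℕ.+ (M ℕ.+ M) ℕ.+ C′ ℕ.+ w ℕ.+ C′ ℕ.+ w)))
          regroup = ℕRing.solve-∀
          split : ∀ M C′ w v v′ → suc (suc (suc (M ℕ.+ M ℕ.+ (v ℕ.+ v′) ℕ.+ C′ ℕ.+ w ℕ.+ C′ ℕ.+ w)))
                                ≡ v′ ℕ.+ (1 ℕ.+ C′) ℕ.+ w ℕ.+ 1 ℕ.+ (suc (M ℕ.+ M) ℕ.+ (v ℕ.+ C′ ℕ.+ w))
          split = ℕRing.solve-∀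

      axisSum-vanishes : symSum B axisTerm ≡ 0ℤ
      axisSum-vanishes = trans (symSum-widen axisTerm axisTerm-supported)
        (x≡-x⇒x≡0 (symSum radius axisTerm) (trans (sym (symSum-widen axisTerm axisTerm-supported)) antisymmetric))
        where
        x≡-x⇒x≡0 : ∀ v → v ≡ - v → v ≡ 0ℤ
        x≡-x⇒x≡0 v h = ℤP.*-cancelʳ-≡ v 0ℤ (+ 2) (trans (ℤP.*-comm v (+ 2)) (trans (ℤP.*-distribʳ-+ v 1ℤ 1ℤ)
          (trans (cong₂ _+_ (ℤP.*-identityˡ v) (trans (ℤP.*-identityˡ v) h)) (ℤP.+-inverseʳ v))))
        g : ℤ → ℤ
        g u = axisTerm (u + mirror)
        swap : ∀ k c → c - k ≡ - k + c
        swap = solve-∀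
        recentre : ∀ W → - (- W + (1ℤ + (W + W))) + 1ℤ ≡ - W
        recentre = solve-∀
        start : ∀ M x y w → - (M + M + (+ 2 + (x + x + (y + y))) + w) + (1ℤ - (x - y) * + 2) ≡ - M - (M + 1ℤ + (x + x + (x + x)) + w)
        start = solve-∀
        length : ∀ M x y w → suc (M ℕ.+ M ℕ.+ (2 ℕ.+ (x ℕ.+ x ℕ.+ (y ℕ.+ y))) ℕ.+ w ℕ.+ (M ℕ.+ M ℕ.+ (2 ℕ.+ (x ℕ.+ x ℕ.+ (y ℕ.+ y))) ℕ.+ w))
          ≡ (M ℕ.+ 1 ℕ.+ (x ℕ.+ x ℕ.+ (x ℕ.+ x)) ℕ.+ w) ℕ.+ (suc (M ℕ.+ M) ℕ.+ (M ℕ.+ 3 ℕ.+ (y ℕ.+ y ℕ.+ (y ℕ.+ y)) ℕ.+ w))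
        length = ℕRing.solve-∀
        antisymmetric : symSum B axisTerm ≡ - symSum radius axisTerm
        antisymmetric = begin
          sumFrom (- + B) width axisTerm                      ≡⟨ sumFrom-cong (- + B) width (λ k → trans (sym (ℤP.neg-involutive (axisTerm k))) (cong -_ (sym (axisTerm-mirror k)))) ⟩
          sumFrom (- + B) width (λ k → - axisTerm (mirror - k)) ≡⟨ sumFrom-neg (- + B) width (λ k → axisTerm (mirror - k)) ⟩
          - sumFrom (- + B) width (λ k → axisTerm (mirror - k)) ≡⟨ cong -_ (sumFrom-cong (- + B) width (λ k → cong axisTerm (swap k mirror))) ⟩
          - sumFrom (- + B) width (λ k → g (- k))             ≡⟨ cong -_ (sumFrom-reflect (- + B) width g) ⟩
          - sumFrom (- (- + B + + width) + 1ℤ) width g        ≡⟨ cong (λ t → - sumFrom t width g) (recentre (+ B)) ⟩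
          - sumFrom (- + B) width g                           ≡⟨ cong -_ (sumFrom-shift (- + B) width mirror axisTerm) ⟩
          - sumFrom (- + B + mirror) width axisTerm
            ≡⟨ cong -_ (sumFrom-window radius axisTerm axisTerm-supported _ _
                 (radius ℕ.+ 1 ℕ.+ (x ℕ.+ x ℕ.+ (x ℕ.+ x)) ℕ.+ w) (radius ℕ.+ 3 ℕ.+ (y ℕ.+ y ℕ.+ (y ℕ.+ y)) ℕ.+ w)
                 (start (+ radius) (+ x) (+ y) (+ w)) (length radius x y w)) ⟩
          - symSum radius axisTerm ∎

      axisWeightTerm : ℤ → ℤ → ℤ
      axisWeightTerm j k = onExp n (sE j k) (axisWeight j k)

      axisWeightTerm-vanishes : ∀ j → symSum B (axisWeightTerm j) ≡ 0ℤ
      axisWeightTerm-vanishes (+ zero)  = axisSum-vanishes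
      axisWeightTerm-vanishes (+ suc m) = sumFrom-zero (- + B) width _ (λ k → onExp-0 n (sE (+ suc m) k))
      axisWeightTerm-vanishes -[1+ m ]  = sumFrom-zero (- + B) width _ (λ k → onExp-0 n (sE -[1+ m ] k))

      stringTerm : ℤ → ℤ → ℤ
      stringTerm j k = onExp n (sE j k) (stringWeight j k)

      stringTerm-split : ∀ j k → stringTerm j k ≡ fTerm (r₁ j k) (s₁ j k) + fTerm (r₂ j k) (s₂ j k) - axisWeightTerm j k
      stringTerm-split j k = trans (cong (onExp n (sE j k)) (stringWeight-split j k))
        (trans (sym (onExp-+- n (sE j k) (fWeight (r₁ j k) (s₁ j k)) (fWeight (r₂ j k) (s₂ j k)) (axisWeight j k)))
          (cong₂ (λ u v → onExp n u (fWeight (r₁ j k) (s₁ j k)) + onExp n v (fWeight (r₂ j k) (s₂ j k)) - axisWeightTerm j k)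
            (sym (fE-r₁s₁≡sE j k)) (sym (fE-r₂s₂≡sE j k))))

      fRows-evenOdd : symSum B (λ j → fRow (j * + 2)) + symSum B (λ k → fRow (1ℤ - k * + 2)) ≡ symSum radius fRow
      fRows-evenOdd = begin
        symSum B (λ j → fRow (j * + 2)) + symSum B (λ k → fRow (1ℤ - k * + 2))         ≡⟨ cong (_+_ (symSum B (λ j → fRow (j * + 2)))) odds ⟩
        sumFrom (- + B) width (λ j → fRow (j * + 2)) + sumFrom (- + B) width g         ≡⟨ sym (sumFrom-evenOdd (- + B) width fRow) ⟩
        sumFrom (- + B * + 2) (width ℕ.+ width) fRow
          ≡⟨ sumFrom-window radius fRow fRow-supported _ _ d (d ℕ.+ 1) (start (+ radius) (+ margin) (+ w)) (length radius margin w) ⟩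
        symSum radius fRow                                                              ∎
        where
        d : ℕ
        d = radius ℕ.+ radius ℕ.+ radius ℕ.+ margin ℕ.+ margin ℕ.+ w ℕ.+ w
        g : ℤ → ℤ
        g i = fRow (i * + 2 + 1ℤ)
        odd : ∀ k → 1ℤ - k * + 2 ≡ (- k) * + 2 + 1ℤ
        odd = solve-∀
        recentre : ∀ W → - (- W + (1ℤ + (W + W))) + 1ℤ ≡ - W
        recentre = solve-∀
        start : ∀ M C w → - (M + M + C + w) * + 2 ≡ - M - (M + M + M + C + C + w + w)
        start = solve-∀
        length : ∀ M C w → suc (M ℕ.+ M ℕ.+ C ℕ.+ w ℕ.+ (M ℕ.+ M ℕ.+ C ℕ.+ w)) ℕ.+ suc (M ℕ.+ M ℕ.+ C ℕ.+ w ℕ.+ (M ℕ.+ M ℕ.+ C ℕ.+ w))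
          ≡ (M ℕ.+ M ℕ.+ M ℕ.+ C ℕ.+ C ℕ.+ w ℕ.+ w) ℕ.+ (suc (M ℕ.+ M) ℕ.+ (M ℕ.+ M ℕ.+ M ℕ.+ C ℕ.+ C ℕ.+ w ℕ.+ w ℕ.+ 1))
        length = ℕRing.solve-∀
        odds : symSum B (λ k → fRow (1ℤ - k * + 2)) ≡ sumFrom (- + B) width g
        odds = trans (sumFrom-cong (- + B) width (λ k → cong fRow (odd k)))
          (trans (sumFrom-reflect (- + B) width g) (cong (λ t → sumFrom t width g) (recentre (+ B))))

      coefficients-agree : stringCoeff (+ (2 ℕ.* K)) (+ K) (+ ℓ) B n
        ≡ fCoeff (+ K + + 1) (+ K + + 1) (+ 1) (+ 1 + half (+ K + + ℓ)) (+ 1 - half (+ K - + ℓ)) B n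
      coefficients-agree = begin
        boxSum B stringTerm                                                 ≡⟨ boxSum≡symSum² B stringTerm ⟩
        symSum B (λ j → symSum B (stringTerm j))
          ≡⟨ sumFrom-cong (- + B) width (λ j → trans (sumFrom-cong (- + B) width (stringTerm-split j))
               (sumFrom-+- (- + B) width (evens j) (odds j) (axisWeightTerm j))) ⟩
        symSum B (λ j → symSum B (evens j) + symSum B (odds j) - symSum B (axisWeightTerm j))
          ≡⟨ sumFrom-+- (- + B) width (λ j → symSum B (evens j)) (λ j → symSum B (odds j)) (λ j → symSum B (axisWeightTerm j)) ⟩
        symSum B (λ j → symSum B (evens j)) + symSum B (λ j → symSum B (odds j)) - symSum B (λ j → symSum B (axisWeightTerm j))
          ≡⟨ cong₂ (λ u v → u + v - symSum B (λ j → symSum B (axisWeightTerm j)))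
               (sumFrom-cong (- + B) width fTerm-r₁s₁-rows)
               (trans (sumFrom-comm (- + B) width (- + B) width odds) (sumFrom-cong (- + B) width fTerm-r₂s₂-columns)) ⟩
        symSum B (λ j → fRow (j * + 2)) + symSum B (λ k → fRow (1ℤ - k * + 2)) - symSum B (λ j → symSum B (axisWeightTerm j))
          ≡⟨ cong (_-_ (symSum B (λ j → fRow (j * + 2)) + symSum B (λ k → fRow (1ℤ - k * + 2))))
               (sumFrom-zero (- + B) width _ axisWeightTerm-vanishes) ⟩
        symSum B (λ j → fRow (j * + 2)) + symSum B (λ k → fRow (1ℤ - k * + 2)) - 0ℤ ≡⟨ ℤP.+-identityʳ _ ⟩
        symSum B (λ j → fRow (j * + 2)) + symSum B (λ k → fRow (1ℤ - k * + 2))       ≡⟨ fRows-evenOdd ⟩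
        symSum radius fRow                                                  ≡⟨ symSum-widen fRow fRow-supported ⟨
        symSum B fRow                                                       ≡⟨ sumFrom-cong (- + B) width (λ r → symSum-widen (fTerm r) (fTerm-row-supported r)) ⟨
        symSum B (λ r → symSum B (fTerm r))                                 ≡⟨ boxSum≡symSum² B fTerm ⟨
        boxSum B fTerm                                                      ∎
        where
        evens odds : ℤ → ℤ → ℤ
        evens j k = fTerm (r₁ j k) (s₁ j k)
        odds j k = fTerm (r₂ j k) (s₂ j k)

    stringCoeff≡fCoeff : ∀ B → threshold ℕ.≤ B → stringCoeff (+ (2 ℕ.* K)) (+ K) (+ ℓ) B n
      ≡ fCoeff (+ K + + 1) (+ K + + 1) (+ 1) (+ 1 + half (+ K + + ℓ)) (+ 1 - half (+ K - + ℓ)) B n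
    stringCoeff≡fCoeff B threshold≤B with ℕP.m≤n⇒∃[o]m+o≡n threshold≤B
    ... | w , refl = Window.coefficients-agree w

open import Data.Nat using (ℕ; _≤_; _%_; _*_)
open import Data.Integer using (ℤ; +_; _+_; _-_)
open import Data.Product using (∃-syntax; _,_)
open import Relation.Binary.PropositionalEquality using (_≡_)

corollary1p3 : (K : ℕ) → 1 ≤ K → (ℓ : ℕ) → ℓ ≤ 2 * K → K % 2 ≡ ℓ % 2 →
    (n : ℤ) → ∃[ B₀ ] ((B : ℕ) → B₀ ≤ B →
      stringCoeff (+ (2 * K)) (+ K) (+ ℓ) B n
        ≡ fCoeff (+ K + + 1) (+ K + + 1) (+ 1)
                 (+ 1 + half (+ K + + ℓ)) (+ 1 - half (+ K - + ℓ)) B n)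
corollary1p3 K _ ℓ _ K≡ℓ n = threshold , stringCoeff≡fCoeff
  where
  open Corollary (Parity.halves K ℓ K≡ℓ)
  open Coefficient n
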